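{- Let $n\ge2$, $\lambda$ a partition, $i\in\{1,\dots,n-1\}$, and $T,T'\in\mathrm{MVT}^n(\lambda)$. Then $e_iT\in\mathrm{MVT}^n(\lambda)\sqcup\{0\}$, $f_iT'\in\mathrm{MVT}^n(\lambda)\sqcup\{0\}$, and $e_iT=T'$ if and only if $T=f_iT'$.
   Context: Partitions are drawn in English convention. A multiset-valued tableau of shape $\lambda$ with entries at most $n$ is a filling $T$ of the boxes of the Young diagram of $\lambda$ by finite nonempty multisets of integers in $\{1,\dots,n\}$ such that whenever a box with multiset $A$ is immediately to the left of a box with multiset $B$ in the same row, $\max A\le \min B$, and whenever a box with multiset $C$ is immediately below a box with multiset $A$ in the same column, $\max A<\min C$. $\mathrm{MVT}^n(\lambda)$ is the set of such tableaux. Reading word: for a column $C$, $\mathrm{rd}(C)$ first reads the smallest entry of each box, boxes from bottom to top, then the remaining entries of each box (one copy of its minimum removed) from smallest to largest, boxes from top to bottom; $\mathrm{rd}(T)=\mathrm{rd}(C_1)\cdots\mathrm{rd}(C_k)$ over the columns from left to right. Each letter corresponds to a specific entry of a specific box. For $i\in\{1,\dots,n-1\}$, write $+$ for each letter $i$ and $-$ for each letter $i+1$ of $\mathrm{rd}(T)$ (ignore other letters) and successively cancel pairs $-+$ until a sequence $+\cdots+-\cdots-$ (the $i$-signature) remains. $e_iT$: if there is no uncanceled $-$, $e_iT=0$; otherwise let $\mathsf b$ be the box of the entry giving the leftmost uncanceled $-$; if the box immediately above $\mathsf b$ contains an $i$, remove an $i+1$ from $\mathsf b$ and add an $i$ to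 the box above; otherwise replace that $i+1$ in $\mathsf b$ by $i$. $f_iT$: if there is no uncanceled $+$, $f_iT=0$; otherwise let $\mathsf b$ be the box of the entry giving the rightmost uncanceled $+$; if the box immediately below $\mathsf b$ contains an $i+1$, remove the $i$ from $\mathsf b$ and add an $i+1$ to the box below; otherwise replace that $i$ in $\mathsf b$ by $i+1$. -}

module Defs where

open import Data.Nat using (ℕ; zero; suc; _+_; _∸_; _≤_; _<_; _⊔_; _⊓_; _≤ᵇ_; _≡ᵇ_; _<ᵇ_)
open import Data.Bool using (Bool; true; false; if_then_else_; _∧_; _∨_)
open import Data.List using (List; []; _∷_; _++_; map; concat; concatMap; reverse; length; foldr; upTo; zip; filter; drop)
open import Data.Bool.ListAction using (any)
open import Data.List.Relation.Unary.All using (All)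
open import Data.List.Relation.Unary.Linked using (Linked)
open import Data.Maybe using (Maybe; just; nothing)
open import Data.Product using (_×_; _,_)
open import Data.Unit using (⊤)
open import Relation.Binary.PropositionalEquality using (_≡_; _≢_)
open import Data.Nat using (_<?_)

IsPartition : List ℕ → Set
IsPartition λ′ = Linked (λ a b → b ≤ a) λ′ × All (λ a → 0 < a) λ′

conj : List ℕ → List ℕ
conj λ′ = map (λ j → length (filter (λ a → j <? a) λ′)) (upTo (foldr _⊔_ 0 λ′))

-- Tableaux: a filling is stored column by column (columns left to right),
-- each column lists its boxes from top to bottom, and each box holds a
-- multiset of positive integers stored as a weakly increasing list
-- (canonical representation of a finite multiset).

Box : Set
Box = List ℕ

Column : Set
Column = List Box

Tableau : Set
Tableau = List Column

nth : {A : Set} → ℕ → List A → Maybe A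
nth _ [] = nothing
nth zero (x ∷ xs) = just x
nth (suc k) (x ∷ xs) = nth k xs

modifyAt : {A : Set} → ℕ → (A → A) → List A → List A
modifyAt _ g [] = []
modifyAt zero g (x ∷ xs) = g x ∷ xs
modifyAt (suc k) g (x ∷ xs) = x ∷ modifyAt k g xs

-- box in column c, row r (both 0-based; row 0 is the top row)
boxAt : Tableau → ℕ → ℕ → Maybe Box
boxAt T c r with nth c T
... | nothing = nothing
... | just C = nth r C

modifyBox : ℕ → ℕ → (Box → Box) → Tableau → Tableau
modifyBox c r g T = modifyAt c (modifyAt r g) T

maxL : List ℕ → ℕ
maxL xs = foldr _⊔_ 0 xs

minL : List ℕ → ℕ
minL [] = 0
minL (x ∷ xs) = foldr _⊓_ x xs

IsBox : ℕ → Box → Set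
IsBox n B = B ≢ [] × Linked _≤_ B × All (λ x → 1 ≤ x × x ≤ n) B

record IsMVT (n : ℕ) (λ′ : List ℕ) (T : Tableau) : Set where
  field
    shape   : map length T ≡ conj λ′
    boxes   : All (All (IsBox n)) T
    rowCond : ∀ c r A B → boxAt T c r ≡ just A → boxAt T (suc c) r ≡ just B →
              maxL A ≤ minL B
    colCond : ∀ c r A C → boxAt T c r ≡ just A → boxAt T c (suc r) ≡ just C →
              maxL A < minL C

-- an element of MVT^n(λ) ⊔ {0}; the crystal value 0 is `nothing`
InMVTor0 : ℕ → List ℕ → Maybe Tableau → Set
InMVTor0 n λ′ nothing = ⊤
InMVTor0 n λ′ (just T) = IsMVT n λ′ T

-- Reading word: each letter is (value , column , row) so that it records
-- the box it comes from.

Letter : Set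
Letter = ℕ × ℕ × ℕ

indexed : {A : Set} → List A → List (ℕ × A)
indexed xs = zip (upTo (length xs)) xs

headL : List ℕ → List ℕ
headL [] = []
headL (x ∷ _) = x ∷ []

rdCol : ℕ → Column → List Letter
rdCol c C =
  reverse (concatMap (λ { (r , B) → map (λ x → (x , c , r)) (headL B) }) (indexed C))
  ++ concatMap (λ { (r , B) → map (λ x → (x , c , r)) (drop 1 B) }) (indexed C)

rd : Tableau → List Letter
rd T = concatMap (λ { (c , C) → rdCol c C }) (indexed T)

data Sign : Set where
  plus minus : Sign

SLetter : Set
SLetter = Sign × ℕ × ℕ   -- sign and (column , row) of its box

signOf : ℕ → Letter → List SLetter
signOf i (x , c , r) =
  if x ≡ᵇ i then (plus , c , r) ∷ []
  else if x ≡ᵇ suc i then (minus , c , r) ∷ [] else []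

cancelOnce : List SLetter → List SLetter
cancelOnce [] = []
cancelOnce ((minus , _) ∷ (plus , _) ∷ xs) = xs
cancelOnce (x ∷ xs) = x ∷ cancelOnce xs

iter : {A : Set} → ℕ → (A → A) → A → A
iter zero g a = a
iter (suc k) g a = iter k g (g a)

-- successively cancel -+ pairs until none is left (at most length/2 steps)
reduceSig : List SLetter → List SLetter
reduceSig w = iter (length w) cancelOnce w

signature : ℕ → Tableau → List SLetter
signature i T = reduceSig (concatMap (signOf i) (rd T))

firstMinus : List SLetter → Maybe (ℕ × ℕ)
firstMinus [] = nothing
firstMinus ((minus , p) ∷ _) = just p
firstMinus ((plus , _) ∷ xs) = firstMinus xs

firstPlus : List SLetter → Maybe (ℕ × ℕ)
firstPlus [] = nothing
firstPlus ((plus , p) ∷ _) = just p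
firstPlus ((minus , _) ∷ xs) = firstPlus xs

insertM : ℕ → Box → Box
insertM x [] = x ∷ []
insertM x (y ∷ ys) = if x ≤ᵇ y then x ∷ y ∷ ys else y ∷ insertM x ys

removeOne : ℕ → Box → Box
removeOne x [] = []
removeOne x (y ∷ ys) = if x ≡ᵇ y then ys else y ∷ removeOne x ys

contains : ℕ → Maybe Box → Bool
contains x nothing = false
contains x (just B) = any (λ y → x ≡ᵇ y) B

e : ℕ → Tableau → Maybe Tableau
e i T with firstMinus (signature i T)
... | nothing = nothing
... | just (c , zero) = just (modifyBox c zero (λ B → insertM i (removeOne (suc i) B)) T)
... | just (c , suc r) =
  if contains i (boxAt T c r)
  then just (modifyBox c r (insertM i) (modifyBox c (suc r) (removeOne (suc i)) T))
  else just (modifyBox c (suc r) (λ B → insertM i (removeOne (suc i) B)) T)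

f : ℕ → Tableau → Maybe Tableau
f i T with firstPlus (reverse (signature i T))
... | nothing = nothing
... | just (c , r) =
  if contains (suc i) (boxAt T c (suc r))
  then just (modifyBox c (suc r) (insertM (suc i)) (modifyBox c r (removeOne i) T))
  else just (modifyBox c r (λ B → insertM (suc i) (removeOne i B)) T)

module Submission where

-- In a multiset-valued tableau the entries i and i+1 of a
-- column either sit in a single box, or i sits directly above a box starting with i+1, so a column
-- contributes +ᵃ-ᵇ, resp. -+ᵃ-ᵇ, all other boxes being neutral. Hence the leftmost unmatched - is the
-- first - of such a block, and e_i turns it into a + at the same place of the word (moving an i+1
-- up in the second case); this + is then the rightmost unmatched + of the new tableau, so f_i undoes
-- e_i, and symmetrically. That the result is again a tableau is a local check around the changed
-- boxes; the one non-local case, a neighbour in the adjacent column containing i+1 (resp. i), would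
-- give an unmatched - before (resp. + after) the chosen letter.

open import Defs
open import Data.Nat
  using (ℕ; zero; suc; _+_; _≤_; _<_; _≰_; _⊔_; _⊓_; _≤ᵇ_; _<ᵇ_; _≡ᵇ_; _≟_; _≤?_; _<?_; z≤n; s≤s)
open import Data.Nat.Properties
open import Data.Bool using (true; false; if_then_else_) renaming (T to True)
open import Data.List
  using (List; []; _∷_; _++_; length; map; concatMap; reverse; foldr; filter; zip; drop; applyUpTo; replicate)
open import Data.List.Properties
  using (∷-injective; ++-assoc; ++-identityʳ; ++-conicalʳ; foldr-++; concatMap-++; reverse-++; unfold-reverse; map-upTo)
open import Data.List.Membership.Propositional using (_∈_)
open import Data.List.Membership.DecPropositional _≟_ using (_∈?_)
open import Data.List.Relation.Unary.All as All using (All; []; _∷_)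
import Data.List.Relation.Unary.All.Properties as All
open import Data.List.Relation.Unary.Any using (here; there)
open import Data.List.Relation.Unary.Linked as Linked using (Linked; []; [-]; _∷_)
open import Data.List.Relation.Unary.Linked.Properties using (Linked⇒All)
open import Data.Maybe as Maybe using (Maybe; just; nothing; _<∣>_; _>>=_)
open import Data.Maybe.Properties using (just-injective)
open import Data.Product using (Σ-syntax; _×_; _,_; proj₁; proj₂)
open import Data.Sum using (_⊎_; inj₁; inj₂)
open import Data.Unit using (tt)
open import Data.Empty using (⊥; ⊥-elim)
open import Function using (_∘_; flip)
open import Function.Bundles using (_⇔_; mk⇔)
open import Relation.Nullary using (¬_; yes; no)
open import Relation.Binary.PropositionalEquality
  using (_≡_; _≢_; refl; sym; trans; cong; cong₂; subst; module ≡-Reasoning)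

-- Reduction of signatures

IsPlus IsMinus : SLetter → Set
IsPlus l = proj₁ l ≡ plus
IsMinus l = proj₁ l ≡ minus

AllPlus AllMinus : List SLetter → Set
AllPlus = All IsPlus
AllMinus = All IsMinus

plus≢minus : ∀ {l} → IsPlus l → ¬ IsMinus l
plus≢minus refl ()

pushSign : SLetter → List SLetter → List SLetter
pushSign (minus , _) ((plus , _) ∷ w) = w
pushSign l w = l ∷ w

-- The normal form reached by reduceSig, computed as a right fold.
reduced : List SLetter → List SLetter
reduced = foldr pushSign []

data IsReduced : List SLetter → Set where
  minuses : ∀ {w} → AllMinus w → IsReduced w
  plus∷ : ∀ {p w} → IsReduced w → IsReduced ((plus , p) ∷ w)

isReduced-minus∷ : ∀ {q w} → IsReduced ((minus , q) ∷ w) → AllMinus ((minus , q) ∷ w)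
isReduced-minus∷ (minuses ms) = ms

reduced-cancelOnce : ∀ w → reduced (cancelOnce w) ≡ reduced w
reduced-cancelOnce [] = refl
reduced-cancelOnce ((minus , _) ∷ (plus , _) ∷ _) = refl
reduced-cancelOnce ((plus , p) ∷ w) = cong (pushSign (plus , p)) (reduced-cancelOnce w)
reduced-cancelOnce ((minus , _) ∷ []) = refl
reduced-cancelOnce ((minus , p) ∷ (minus , q) ∷ w) =
  cong (pushSign (minus , p)) (reduced-cancelOnce ((minus , q) ∷ w))

cancelOnce-fixed-or-shrinks : ∀ w →
  (cancelOnce w ≡ w × IsReduced w) ⊎ suc (suc (length (cancelOnce w))) ≡ length w
cancelOnce-fixed-or-shrinks [] = inj₁ (refl , minuses [])
cancelOnce-fixed-or-shrinks ((minus , _) ∷ (plus , _) ∷ _) = inj₂ refl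
cancelOnce-fixed-or-shrinks ((plus , p) ∷ w) with cancelOnce-fixed-or-shrinks w
... | inj₁ (fixed , red) = inj₁ (cong ((plus , p) ∷_) fixed , plus∷ red)
... | inj₂ shrinks = inj₂ (cong suc shrinks)
cancelOnce-fixed-or-shrinks ((minus , _) ∷ []) = inj₁ (refl , minuses (refl ∷ []))
cancelOnce-fixed-or-shrinks ((minus , p) ∷ (minus , q) ∷ w) with cancelOnce-fixed-or-shrinks ((minus , q) ∷ w)
... | inj₁ (fixed , red) = inj₁ (cong ((minus , p) ∷_) fixed , minuses (refl ∷ isReduced-minus∷ red))
... | inj₂ shrinks = inj₂ (cong suc shrinks)

iter-fixedPoint : ∀ {A : Set} (g : A → A) k a → g a ≡ a → iter k g a ≡ a
iter-fixedPoint g zero a _ = refl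
iter-fixedPoint g (suc k) a fixed rewrite fixed = iter-fixedPoint g k a fixed

reduced-iter-cancelOnce : ∀ k w → reduced (iter k cancelOnce w) ≡ reduced w
reduced-iter-cancelOnce zero w = refl
reduced-iter-cancelOnce (suc k) w = trans (reduced-iter-cancelOnce k (cancelOnce w)) (reduced-cancelOnce w)

isReduced-iter-cancelOnce : ∀ k w → length w ≤ k → IsReduced (iter k cancelOnce w)
isReduced-iter-cancelOnce zero [] _ = minuses []
isReduced-iter-cancelOnce (suc k) w w≤k with cancelOnce-fixed-or-shrinks w
... | inj₁ (fixed , red) rewrite fixed | iter-fixedPoint cancelOnce k w fixed = red
... | inj₂ shrinks = isReduced-iter-cancelOnce k (cancelOnce w)
  (≤-pred (≤-trans (≤-trans (n≤1+n _) (≤-reflexive shrinks)) w≤k))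

pushSign-allMinus : ∀ l w → AllMinus w → pushSign l w ≡ l ∷ w
pushSign-allMinus (plus , _) w _ = refl
pushSign-allMinus (minus , _) [] _ = refl
pushSign-allMinus (minus , _) ((minus , _) ∷ w) _ = refl
pushSign-allMinus (minus , _) ((plus , _) ∷ w) (() ∷ _)

reduced-isReduced : ∀ w → IsReduced w → reduced w ≡ w
reduced-isReduced [] _ = refl
reduced-isReduced ((plus , p) ∷ w) (plus∷ red) = cong ((plus , p) ∷_) (reduced-isReduced w red)
reduced-isReduced ((plus , _) ∷ _) (minuses (() ∷ _))
reduced-isReduced ((minus , p) ∷ w) (minuses (_ ∷ ms))
  rewrite reduced-isReduced w (minuses ms) = pushSign-allMinus (minus , p) w ms

reduceSig≡reduced : ∀ w → reduceSig w ≡ reduced w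
reduceSig≡reduced w = trans (sym (reduced-isReduced _ (isReduced-iter-cancelOnce (length w) w ≤-refl)))
                            (reduced-iter-cancelOnce (length w) w)

isReduced-reduced : ∀ w → IsReduced (reduced w)
isReduced-reduced [] = minuses []
isReduced-reduced ((plus , p) ∷ w) = plus∷ (isReduced-reduced w)
isReduced-reduced ((minus , p) ∷ w) = push (reduced w) (isReduced-reduced w)
  where
  push : ∀ z → IsReduced z → IsReduced (pushSign (minus , p) z)
  push [] _ = minuses (refl ∷ [])
  push ((plus , _) ∷ z) (plus∷ red) = red
  push ((plus , _) ∷ z) (minuses (() ∷ _))
  push ((minus , _) ∷ z) (minuses ms) = minuses (refl ∷ ms)

pushSign-foldr : ∀ l u z → pushSign l (foldr pushSign z u) ≡ foldr pushSign z (pushSign l u)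
pushSign-foldr (plus , _) u z = refl
pushSign-foldr (minus , _) [] z = refl
pushSign-foldr (minus , _) ((plus , _) ∷ u) z = refl
pushSign-foldr (minus , _) ((minus , _) ∷ u) z = refl

foldr-pushSign-reduced : ∀ u z → foldr pushSign z u ≡ foldr pushSign z (reduced u)
foldr-pushSign-reduced [] z = refl
foldr-pushSign-reduced (l ∷ u) z =
  trans (cong (pushSign l) (foldr-pushSign-reduced u z)) (pushSign-foldr l (reduced u) z)

foldr-pushSign-allPlus : ∀ u z → AllPlus u → foldr pushSign z u ≡ u ++ z
foldr-pushSign-allPlus [] z _ = refl
foldr-pushSign-allPlus ((plus , p) ∷ u) z (_ ∷ ps) = cong ((plus , p) ∷_) (foldr-pushSign-allPlus u z ps)

reduced-++ : ∀ u v → reduced (u ++ v) ≡ foldr pushSign (reduced v) u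
reduced-++ u v = foldr-++ pushSign [] u v

reduced-pivot : ∀ u l v → AllPlus (reduced u) → AllMinus (reduced v) →
                reduced (u ++ l ∷ v) ≡ reduced u ++ l ∷ reduced v
reduced-pivot u l v ps ms = begin
  reduced (u ++ l ∷ v)                       ≡⟨ reduced-++ u (l ∷ v) ⟩
  foldr pushSign (pushSign l (reduced v)) u  ≡⟨ cong (flip (foldr pushSign) u) (pushSign-allMinus l (reduced v) ms) ⟩
  foldr pushSign (l ∷ reduced v) u           ≡⟨ foldr-pushSign-reduced u _ ⟩
  foldr pushSign (l ∷ reduced v) (reduced u) ≡⟨ foldr-pushSign-allPlus (reduced u) _ ps ⟩
  reduced u ++ l ∷ reduced v                 ∎
  where open ≡-Reasoning

record Unbracketed (w : List SLetter) (l : SLetter) : Set where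
  constructor unbracketed
  field
    before after : List SLetter
    split : w ≡ before ++ l ∷ after
    before-plus : AllPlus (reduced before)
    after-minus : AllMinus (reduced after)

pushSign-minus-allPlus : ∀ q z → AllPlus z → z ≢ [] → AllPlus (pushSign (minus , q) z)
pushSign-minus-allPlus q [] _ z≢[] = ⊥-elim (z≢[] refl)
pushSign-minus-allPlus q ((plus , _) ∷ z) (_ ∷ ps) _ = ps

allPlus-pushSign : ∀ l w → AllPlus (pushSign l w) → AllPlus w
allPlus-pushSign (plus , _) w (_ ∷ ps) = ps
allPlus-pushSign (minus , _) [] _ = []
allPlus-pushSign (minus , _) ((plus , _) ∷ w) ps = refl ∷ ps
allPlus-pushSign (minus , _) ((minus , _) ∷ w) (() ∷ _)

allPlus-foldr-pushSign : ∀ a z → AllPlus (foldr pushSign z a) → AllPlus z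
allPlus-foldr-pushSign [] z ps = ps
allPlus-foldr-pushSign (l ∷ a) z ps = allPlus-foldr-pushSign a z (allPlus-pushSign l _ ps)

allMinus-foldr-pushSign : ∀ {z} y → IsReduced z → AllMinus (foldr pushSign y z) → AllMinus z
allMinus-foldr-pushSign y (minuses ms) _ = ms
allMinus-foldr-pushSign y (plus∷ _) (() ∷ _)

allPlus-reduced-suffix : ∀ a b → AllPlus (reduced (a ++ b)) → AllPlus (reduced b)
allPlus-reduced-suffix a b ps = allPlus-foldr-pushSign a _ (subst AllPlus (reduced-++ a b) ps)

allMinus-reduced-prefix : ∀ a b → AllMinus (reduced (a ++ b)) → AllMinus (reduced a)
allMinus-reduced-prefix a b ms = allMinus-foldr-pushSign (reduced b) (isReduced-reduced a)
  (subst AllMinus (trans (reduced-++ a b) (foldr-pushSign-reduced a (reduced b))) ms)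

firstMinus-allPlus : ∀ u p v → AllPlus u → firstMinus (u ++ (minus , p) ∷ v) ≡ just p
firstMinus-allPlus [] p v _ = refl
firstMinus-allPlus ((plus , _) ∷ u) p v (_ ∷ ps) = firstMinus-allPlus u p v ps

firstPlus-++ : ∀ xs ys → firstPlus (xs ++ ys) ≡ (firstPlus xs <∣> firstPlus ys)
firstPlus-++ [] ys = refl
firstPlus-++ ((plus , _) ∷ xs) ys = refl
firstPlus-++ ((minus , _) ∷ xs) ys = firstPlus-++ xs ys

firstPlus-reverse-∷ : ∀ l w → firstPlus (reverse (l ∷ w)) ≡ (firstPlus (reverse w) <∣> firstPlus (l ∷ []))
firstPlus-reverse-∷ l w = trans (cong firstPlus (unfold-reverse l w)) (firstPlus-++ (reverse w) (l ∷ []))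

firstPlus-reverse-allMinus : ∀ w → AllMinus w → firstPlus (reverse w) ≡ nothing
firstPlus-reverse-allMinus [] _ = refl
firstPlus-reverse-allMinus ((minus , p) ∷ w) (_ ∷ ms)
  rewrite firstPlus-reverse-∷ (minus , p) w | firstPlus-reverse-allMinus w ms = refl

lastPlus-allMinus : ∀ u p v → AllMinus v → firstPlus (reverse (u ++ (plus , p) ∷ v)) ≡ just p
lastPlus-allMinus u p v ms
  rewrite reverse-++ u ((plus , p) ∷ v) | firstPlus-++ (reverse ((plus , p) ∷ v)) (reverse u)
        | firstPlus-reverse-∷ (plus , p) v | firstPlus-reverse-allMinus v ms = refl

isReduced-noLastPlus : ∀ {z} → IsReduced z → firstPlus (reverse z) ≡ nothing → AllMinus z
isReduced-noLastPlus (minuses ms) _ = ms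
isReduced-noLastPlus (plus∷ {p} {z} _) none
  rewrite firstPlus-reverse-∷ (plus , p) z with firstPlus (reverse z)
isReduced-noLastPlus (plus∷ _) () | just _
isReduced-noLastPlus (plus∷ _) () | nothing

firstMinus-unbracketed : ∀ w p → firstMinus (reduced w) ≡ just p → Unbracketed w (minus , p)
firstMinus-unbracketed ((plus , q) ∷ w) p fm with firstMinus-unbracketed w p fm
... | unbracketed u v refl ps ms = unbracketed ((plus , q) ∷ u) v refl (refl ∷ ps) ms
firstMinus-unbracketed ((minus , q) ∷ w) p fm with reduced w in eq | isReduced-reduced w
firstMinus-unbracketed ((minus , q) ∷ w) p refl | [] | _ = unbracketed [] w refl [] (subst AllMinus (sym eq) [])
firstMinus-unbracketed ((minus , q) ∷ w) p refl | (minus , _) ∷ _ | red =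
  unbracketed [] w refl [] (subst AllMinus (sym eq) (isReduced-minus∷ red))
firstMinus-unbracketed ((minus , q) ∷ w) p fm | (plus , q′) ∷ z | _
  with firstMinus-unbracketed w p (trans (cong firstMinus eq) fm)
... | unbracketed u v refl ps ms = unbracketed ((minus , q) ∷ u) v refl
        (pushSign-minus-allPlus q (reduced u) ps nonempty) ms
  where
  nonempty : reduced u ≢ []
  nonempty empty with trans (sym eq) (reduced-pivot u (minus , p) v ps ms)
  ... | head≡ rewrite empty with head≡
  ... | ()

lastPlus-unbracketed : ∀ w p → firstPlus (reverse (reduced w)) ≡ just p → Unbracketed w (plus , p)
lastPlus-unbracketed ((plus , q) ∷ w) p lp
  rewrite firstPlus-reverse-∷ (plus , q) (reduced w) with firstPlus (reverse (reduced w)) in lp′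
... | just _ with refl ← lp with lastPlus-unbracketed w p lp′
...   | unbracketed u v refl ps ms = unbracketed ((plus , q) ∷ u) v refl (refl ∷ ps) ms
lastPlus-unbracketed ((plus , q) ∷ w) p refl | nothing =
  unbracketed [] w refl [] (isReduced-noLastPlus (isReduced-reduced w) lp′)
lastPlus-unbracketed ((minus , q) ∷ w) p lp with reduced w in eq | isReduced-reduced w
... | [] | _ with () ← lp
... | (minus , q′) ∷ z | red with () ← trans (sym lp) (firstPlus-reverse-allMinus _ (refl ∷ isReduced-minus∷ red))
... | (plus , q′) ∷ z | _ with lastPlus-unbracketed w p lp″
  where
  lp″ : firstPlus (reverse (reduced w)) ≡ just p
  lp″ rewrite eq | firstPlus-reverse-∷ (plus , q′) z | lp = refl
... | unbracketed u v refl ps ms = unbracketed ((minus , q) ∷ u) v refl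
        (pushSign-minus-allPlus q (reduced u) ps nonempty) ms
  where
  nonempty : reduced u ≢ []
  nonempty empty with trans (sym eq) (reduced-pivot u (plus , p) v ps ms)
  ... | head≡ rewrite empty with head≡
  ... | refl with () ← trans (sym lp) (firstPlus-reverse-allMinus _ ms)

isReduced-++ : ∀ {ps ms} → AllPlus ps → AllMinus ms → IsReduced (ps ++ ms)
isReduced-++ [] ms = minuses ms
isReduced-++ {(plus , _) ∷ _} (_ ∷ ps) ms = plus∷ (isReduced-++ ps ms)

reduced-allMinus : ∀ w → AllMinus w → reduced w ≡ w
reduced-allMinus w ms = reduced-isReduced w (minuses ms)

reduced-plus∷ : ∀ l w → IsPlus l → reduced (l ∷ w) ≡ l ∷ reduced w
reduced-plus∷ (plus , _) w refl = refl

firstMinus-in-reduced : ∀ x l y {ps ms} → AllPlus ps → AllMinus ms → x ++ l ∷ y ≡ ps ++ ms →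
                        IsMinus l → AllPlus (reduced x) → x ≡ ps × l ∷ y ≡ ms
firstMinus-in-reduced [] l y {[]} _ _ eq _ _ = refl , eq
firstMinus-in-reduced [] l y {_ ∷ _} (lp ∷ _) _ refl lm _ = ⊥-elim (plus≢minus {l} lp lm)
firstMinus-in-reduced (x₀ ∷ x) l y {[]} _ ms refl _ xp with All.++⁻ˡ (x₀ ∷ x) ms
... | m₀ ∷ xms with subst AllPlus (reduced-allMinus (x₀ ∷ x) (m₀ ∷ xms)) xp
...   | p₀ ∷ _ = ⊥-elim (plus≢minus {x₀} p₀ m₀)
firstMinus-in-reduced (x₀ ∷ x) l y {_ ∷ _} (p₀ ∷ ps) ms eq lm xp with ∷-injective eq
... | refl , eq′
  with firstMinus-in-reduced x l y ps ms eq′ lm (All.tail (subst AllPlus (reduced-plus∷ x₀ x p₀) xp))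
...   | refl , eq″ = refl , eq″

lastPlus-in-reduced : ∀ x l y {ps ms} → AllPlus ps → AllMinus ms → x ++ l ∷ y ≡ ps ++ ms →
                      IsPlus l → AllMinus (reduced y) → x ++ l ∷ [] ≡ ps × y ≡ ms
lastPlus-in-reduced [] l y {[]} _ (lm ∷ _) refl lp _ = ⊥-elim (plus≢minus {l} lp lm)
lastPlus-in-reduced [] l y {_ ∷ []} _ _ refl _ _ = refl , refl
lastPlus-in-reduced [] l y {_ ∷ p₁ ∷ ps} {ms} (_ ∷ p₁p ∷ _) _ refl _ ym
  with subst AllMinus (reduced-plus∷ p₁ (ps ++ ms) p₁p) ym
... | m₁ ∷ _ = ⊥-elim (plus≢minus {p₁} p₁p m₁)
lastPlus-in-reduced (x₀ ∷ x) l y {[]} _ ms refl lp _ with All.++⁻ʳ (x₀ ∷ x) ms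
... | lm ∷ _ = ⊥-elim (plus≢minus {l} lp lm)
lastPlus-in-reduced (x₀ ∷ x) l y {_ ∷ _} (_ ∷ ps) ms eq lp ym with ∷-injective eq
... | refl , eq′ with lastPlus-in-reduced x l y ps ms eq′ lp ym
...   | eq″ , refl = cong (x₀ ∷_) eq″ , refl

reduced-minus-not-allPlus : ∀ {ps m ms} → AllPlus ps → AllMinus (m ∷ ms) → ¬ AllPlus (reduced (ps ++ m ∷ ms))
reduced-minus-not-allPlus {ps} {m} ps-plus ms all
  with All.++⁻ʳ ps (subst AllPlus (reduced-isReduced _ (isReduced-++ ps-plus ms)) all)
... | mp ∷ _ = plus≢minus {m} mp (All.head ms)

reduced-plus-not-allMinus : ∀ {p ps ms} → AllPlus (p ∷ ps) → AllMinus ms → ¬ AllMinus (reduced (p ∷ ps ++ ms))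
reduced-plus-not-allMinus {p} ps ms all
  with subst AllMinus (reduced-isReduced _ (isReduced-++ ps ms)) all
... | pm ∷ _ = plus≢minus {p} (All.head ps) pm

-- Boxes as sorted lists

≡ᵇ-refl : ∀ n → (n ≡ᵇ n) ≡ true
≡ᵇ-refl zero = refl
≡ᵇ-refl (suc n) = ≡ᵇ-refl n

≡ᵇ-true : ∀ m n → (m ≡ᵇ n) ≡ true → m ≡ n
≡ᵇ-true m n eq = ≡ᵇ⇒≡ m n (subst True (sym eq) tt)

≡ᵇ-false : ∀ m n → m ≢ n → (m ≡ᵇ n) ≡ false
≡ᵇ-false m n m≢n with m ≡ᵇ n in eq
... | false = refl
... | true = ⊥-elim (m≢n (≡ᵇ-true m n eq))

≤ᵇ-true : ∀ m n → m ≤ n → (m ≤ᵇ n) ≡ true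
≤ᵇ-true m n m≤n with m ≤ᵇ n in eq
... | true = refl
... | false = ⊥-elim (subst True eq (≤⇒≤ᵇ m≤n))

≤ᵇ-false : ∀ m n → m ≰ n → (m ≤ᵇ n) ≡ false
≤ᵇ-false m n m≰n with m ≤ᵇ n in eq
... | false = refl
... | true = ⊥-elim (m≰n (≤ᵇ⇒≤ m n (subst True (sym eq) tt)))

linked-∷ : ∀ {x xs} → All (x ≤_) xs → Linked _≤_ xs → Linked _≤_ (x ∷ xs)
linked-∷ [] _ = [-]
linked-∷ (x≤y ∷ _) sorted = x≤y ∷ sorted

linked-head-≤ : ∀ {x xs} → Linked _≤_ (x ∷ xs) → All (x ≤_) xs
linked-head-≤ sorted = All.tail (Linked⇒All ≤-trans ≤-refl sorted)

multiplicity : ℕ → List ℕ → ℕ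
multiplicity k [] = 0
multiplicity k (x ∷ xs) = if x ≡ᵇ k then suc (multiplicity k xs) else multiplicity k xs

multiplicity-here : ∀ k xs → multiplicity k (k ∷ xs) ≡ suc (multiplicity k xs)
multiplicity-here k xs rewrite ≡ᵇ-refl k = refl

multiplicity-other : ∀ k x xs → x ≢ k → multiplicity k (x ∷ xs) ≡ multiplicity k xs
multiplicity-other k x xs x≢k rewrite ≡ᵇ-false x k x≢k = refl

multiplicity-absent : ∀ k xs → All (_≢ k) xs → multiplicity k xs ≡ 0
multiplicity-absent k [] _ = refl
multiplicity-absent k (x ∷ xs) (x≢k ∷ rest) rewrite ≡ᵇ-false x k x≢k = multiplicity-absent k xs rest

multiplicity-suc⇒∈ : ∀ k xs m → multiplicity k xs ≡ suc m → k ∈ xs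
multiplicity-suc⇒∈ k (x ∷ xs) m eq with x ≡ᵇ k in x≡ᵇk
... | true = here (sym (≡ᵇ-true x k x≡ᵇk))
... | false = there (multiplicity-suc⇒∈ k xs m eq)

∈⇒multiplicity-suc : ∀ k xs → k ∈ xs → Σ[ m ∈ ℕ ] multiplicity k xs ≡ suc m
∈⇒multiplicity-suc k (x ∷ xs) (here refl) rewrite ≡ᵇ-refl k = multiplicity k xs , refl
∈⇒multiplicity-suc k (x ∷ xs) (there k∈xs) with x ≡ᵇ k
... | true = multiplicity k xs , refl
... | false = ∈⇒multiplicity-suc k xs k∈xs

insertM-nonempty : ∀ x B → insertM x B ≢ []
insertM-nonempty x (y ∷ B) eq with x ≤ᵇ y
insertM-nonempty x (y ∷ B) () | true
insertM-nonempty x (y ∷ B) () | false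

All-insertM : ∀ {P : ℕ → Set} x B → P x → All P B → All P (insertM x B)
All-insertM x [] px _ = px ∷ []
All-insertM x (y ∷ B) px (py ∷ pB) with x ≤ᵇ y
... | true = px ∷ py ∷ pB
... | false = py ∷ All-insertM x B px pB

All-removeOne : ∀ {P : ℕ → Set} x B → All P B → All P (removeOne x B)
All-removeOne x [] _ = []
All-removeOne x (y ∷ B) (py ∷ pB) with x ≡ᵇ y
... | true = pB
... | false = py ∷ All-removeOne x B pB

insertM-sorted : ∀ x B → Linked _≤_ B → Linked _≤_ (insertM x B)
insertM-sorted x [] _ = [-]
insertM-sorted x (y ∷ B) sorted with x ≤? y
... | yes x≤y rewrite ≤ᵇ-true x y x≤y = x≤y ∷ sorted
... | no x≰y rewrite ≤ᵇ-false x y x≰y =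
  linked-∷ (All-insertM x B (<⇒≤ (≰⇒> x≰y)) (linked-head-≤ sorted)) (insertM-sorted x B (Linked.tail sorted))

removeOne-sorted : ∀ x B → Linked _≤_ B → Linked _≤_ (removeOne x B)
removeOne-sorted x [] _ = []
removeOne-sorted x (y ∷ B) sorted with x ≡ᵇ y
... | true = Linked.tail sorted
... | false = linked-∷ (All-removeOne x B (linked-head-≤ sorted)) (removeOne-sorted x B (Linked.tail sorted))

multiplicity-insertM-same : ∀ x B → multiplicity x (insertM x B) ≡ suc (multiplicity x B)
multiplicity-insertM-same x [] = multiplicity-here x []
multiplicity-insertM-same x (y ∷ B) with x ≤? y
... | yes x≤y rewrite ≤ᵇ-true x y x≤y = multiplicity-here x (y ∷ B)
... | no x≰y rewrite ≤ᵇ-false x y x≰y | multiplicity-other x y (insertM x B) (x≰y ∘ ≤-reflexive ∘ sym)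
      | multiplicity-other x y B (x≰y ∘ ≤-reflexive ∘ sym) = multiplicity-insertM-same x B

multiplicity-insertM-other : ∀ k x B → x ≢ k → multiplicity k (insertM x B) ≡ multiplicity k B
multiplicity-insertM-other k x [] x≢k = multiplicity-other k x [] x≢k
multiplicity-insertM-other k x (y ∷ B) x≢k with x ≤ᵇ y
... | true = multiplicity-other k x (y ∷ B) x≢k
... | false with y ≡ᵇ k
...   | true = cong suc (multiplicity-insertM-other k x B x≢k)
...   | false = multiplicity-insertM-other k x B x≢k

multiplicity-removeOne-other : ∀ k x B → x ≢ k → multiplicity k (removeOne x B) ≡ multiplicity k B
multiplicity-removeOne-other k x [] _ = refl
multiplicity-removeOne-other k x (y ∷ B) x≢k with x ≡ᵇ y in x≡ᵇy
... | true rewrite sym (≡ᵇ-true x y x≡ᵇy) | ≡ᵇ-false x k x≢k = refl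
... | false with y ≡ᵇ k
...   | true = cong suc (multiplicity-removeOne-other k x B x≢k)
...   | false = multiplicity-removeOne-other k x B x≢k

multiplicity-removeOne-same : ∀ x B → x ∈ B → suc (multiplicity x (removeOne x B)) ≡ multiplicity x B
multiplicity-removeOne-same x (y ∷ B) x∈ with x ≟ y
... | yes refl rewrite ≡ᵇ-refl x = refl
... | no x≢y with x∈
...   | here x≡y = ⊥-elim (x≢y x≡y)
...   | there x∈B rewrite ≡ᵇ-false x y x≢y | ≡ᵇ-false y x (λ y≡x → x≢y (sym y≡x)) =
  multiplicity-removeOne-same x B x∈B

removeOne-insertM : ∀ x B → removeOne x (insertM x B) ≡ B
removeOne-insertM x [] rewrite ≡ᵇ-refl x = refl
removeOne-insertM x (y ∷ B) with x ≤? y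
... | yes x≤y rewrite ≤ᵇ-true x y x≤y | ≡ᵇ-refl x = refl
... | no x≰y rewrite ≤ᵇ-false x y x≰y | ≡ᵇ-false x y (λ x≡y → x≰y (≤-reflexive x≡y)) =
  cong (y ∷_) (removeOne-insertM x B)

insertM-minimum : ∀ x B → All (x ≤_) B → insertM x B ≡ x ∷ B
insertM-minimum x [] _ = refl
insertM-minimum x (y ∷ B) (x≤y ∷ _) rewrite ≤ᵇ-true x y x≤y = refl

insertM-removeOne : ∀ x B → Linked _≤_ B → x ∈ B → insertM x (removeOne x B) ≡ B
insertM-removeOne x (y ∷ B) sorted x∈ with x ≟ y
... | yes refl rewrite ≡ᵇ-refl x = insertM-minimum x B (linked-head-≤ sorted)
... | no x≢y with x∈
...   | here x≡y = ⊥-elim (x≢y x≡y)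
...   | there x∈B rewrite ≡ᵇ-false x y x≢y
        | ≤ᵇ-false x y (λ x≤y → x≢y (≤-antisym x≤y (All.lookup (linked-head-≤ sorted) x∈B))) =
  cong (y ∷_) (insertM-removeOne x B (Linked.tail sorted) x∈B)

removeOne-head : ∀ k B → removeOne k (k ∷ B) ≡ B
removeOne-head k B rewrite ≡ᵇ-refl k = refl

insertM-head : ∀ k B → insertM k (k ∷ B) ≡ k ∷ k ∷ B
insertM-head k B rewrite ≤ᵇ-true k k ≤-refl = refl

contains-∈ : ∀ x B → x ∈ B → contains x (just B) ≡ true
contains-∈ x (y ∷ B) (here refl) rewrite ≡ᵇ-refl x = refl
contains-∈ x (y ∷ B) (there x∈B) with x ≡ᵇ y
... | true = refl
... | false = contains-∈ x B x∈B

contains-∉ : ∀ x B → All (_≢ x) B → contains x (just B) ≡ false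
contains-∉ x [] _ = refl
contains-∉ x (y ∷ B) (y≢x ∷ rest) rewrite ≡ᵇ-false x y (λ x≡y → y≢x (sym x≡y)) = contains-∉ x B rest

∈-maxL : ∀ {x} B → x ∈ B → x ≤ maxL B
∈-maxL (y ∷ B) (here refl) = m≤m⊔n y (maxL B)
∈-maxL (y ∷ B) (there x∈B) = ≤-trans (∈-maxL B x∈B) (m≤n⊔m y (maxL B))

maxL∈ : ∀ B → B ≢ [] → maxL B ∈ B
maxL∈ [] B≢[] = ⊥-elim (B≢[] refl)
maxL∈ (x ∷ B) _ = go x B
  where
  go : ∀ x B → maxL (x ∷ B) ∈ x ∷ B
  go x [] = here (⊔-identityʳ x)
  go x (y ∷ B) with ⊔-sel x (maxL (y ∷ B))
  ... | inj₁ eq = here eq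
  ... | inj₂ eq = there (subst (_∈ y ∷ B) (sym eq) (go y B))

minL-∈ : ∀ {x} B → x ∈ B → minL B ≤ x
minL-∈ (y ∷ B) = go y B
  where
  go : ∀ {x} y B → x ∈ y ∷ B → foldr _⊓_ y B ≤ x
  go y [] (here refl) = ≤-refl
  go y (z ∷ B) (here refl) = ≤-trans (m⊓n≤n z (foldr _⊓_ y B)) (go y B (here refl))
  go y (z ∷ B) (there (here refl)) = m⊓n≤m z (foldr _⊓_ y B)
  go y (z ∷ B) (there (there x∈B)) = ≤-trans (m⊓n≤n z (foldr _⊓_ y B)) (go y B (there x∈B))

minL∈ : ∀ B → B ≢ [] → minL B ∈ B
minL∈ [] B≢[] = ⊥-elim (B≢[] refl)
minL∈ (x ∷ B) _ = go B
  where
  go : ∀ B → foldr _⊓_ x B ∈ x ∷ B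
  go [] = here refl
  go (z ∷ B) with ⊓-sel z (foldr _⊓_ x B)
  ... | inj₁ eq = there (here eq)
  ... | inj₂ eq with go B
  ...   | here eq′ = here (trans eq eq′)
  ...   | there m = there (there (subst (_∈ B) (sym eq) m))

minL≤maxL : ∀ B → B ≢ [] → minL B ≤ maxL B
minL≤maxL B B≢[] = ∈-maxL B (minL∈ B B≢[])

All-≤-maxL : ∀ B → All (_≤ maxL B) B
All-≤-maxL B = All.tabulate (∈-maxL B)

All-minL-≤ : ∀ B → All (minL B ≤_) B
All-minL-≤ B = All.tabulate (minL-∈ B)

sorted-minimum-head : ∀ {k B} → Linked _≤_ B → k ∈ B → All (k ≤_) B →
                      Σ[ B₀ ∈ List ℕ ] B ≡ k ∷ B₀
sorted-minimum-head {B = y ∷ B} _ (here refl) _ = B , refl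
sorted-minimum-head {B = y ∷ B} sorted (there k∈B) (k≤y ∷ _)
  with ≤-antisym (All.lookup (linked-head-≤ sorted) k∈B) k≤y
... | refl = B , refl

squeezed-∈ : ∀ {k} B → B ≢ [] → maxL B ≤ k → k ≤ minL B → k ∈ B
squeezed-∈ B B≢[] max≤k k≤min =
  subst (_∈ B) (≤-antisym (≤-trans (minL≤maxL B B≢[]) max≤k) k≤min) (minL∈ B B≢[])

∈⇒≢[] : ∀ {k : ℕ} {B} → k ∈ B → B ≢ []
∈⇒≢[] (here _) ()
∈⇒≢[] (there _) ()

-- Positions in lists and tableaux

indexedFrom : ∀ {A : Set} → ℕ → List A → List (ℕ × A)
indexedFrom k [] = []
indexedFrom k (x ∷ xs) = (k , x) ∷ indexedFrom (suc k) xs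

zip-applyUpTo : ∀ {A : Set} (f : ℕ → ℕ) k (xs : List A) → (∀ m → f m ≡ k + m) →
                zip (applyUpTo f (length xs)) xs ≡ indexedFrom k xs
zip-applyUpTo f k [] _ = refl
zip-applyUpTo f k (x ∷ xs) f≗ = cong₂ _∷_ (cong (_, x) (trans (f≗ 0) (+-identityʳ k)))
  (zip-applyUpTo (f ∘ suc) (suc k) xs (λ m → trans (f≗ (suc m)) (+-suc k m)))

indexed≡indexedFrom0 : ∀ {A : Set} (xs : List A) → indexed xs ≡ indexedFrom 0 xs
indexed≡indexedFrom0 xs = zip-applyUpTo (λ m → m) 0 xs (λ _ → refl)

All-reverse : ∀ {A : Set} {P : A → Set} xs → All P xs → All P (reverse xs)
All-reverse [] [] = []
All-reverse (x ∷ xs) (px ∷ pxs) rewrite unfold-reverse x xs = All.++⁺ (All-reverse xs pxs) (px ∷ [])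

∷≡replicate : ∀ {A : Set} {l z : A} {y} b → l ∷ y ≡ replicate b z →
              Σ[ b′ ∈ ℕ ] b ≡ suc b′ × l ≡ z × y ≡ replicate b′ z
∷≡replicate (suc b′) refl = b′ , refl , refl , refl

∷ʳ≡replicate : ∀ {A : Set} {l z : A} x a → x ++ l ∷ [] ≡ replicate a z →
               Σ[ a′ ∈ ℕ ] a ≡ suc a′ × l ≡ z × x ≡ replicate a′ z
∷ʳ≡replicate [] (suc zero) refl = zero , refl , refl , refl
∷ʳ≡replicate [] (suc (suc a)) ()
∷ʳ≡replicate (x₀ ∷ x) (suc a) eq with ∷-injective eq
... | refl , eq′ with ∷ʳ≡replicate x a eq′
...   | a′ , refl , refl , refl = suc a′ , refl , refl , refl

replicate-∷ʳ : ∀ {A : Set} a (z : A) w → replicate (suc a) z ++ w ≡ replicate a z ++ z ∷ w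
replicate-∷ʳ zero z w = refl
replicate-∷ʳ (suc a) z w = cong (z ∷_) (replicate-∷ʳ a z w)

nth-++-∷ : ∀ {A : Set} (xs : List A) y ys r → length xs ≡ r → nth r (xs ++ y ∷ ys) ≡ just y
nth-++-∷ [] y ys zero refl = refl
nth-++-∷ (x ∷ xs) y ys (suc r) refl = nth-++-∷ xs y ys r refl

nth-suc-++-∷ : ∀ {A : Set} (xs : List A) y ys r → length xs ≡ r → nth (suc r) (xs ++ y ∷ ys) ≡ nth 0 ys
nth-suc-++-∷ [] y ys zero refl = refl
nth-suc-++-∷ (x ∷ xs) y ys (suc r) refl = nth-suc-++-∷ xs y ys r refl

nth⇒∈ : ∀ {A : Set} k (xs : List A) {a} → nth k xs ≡ just a → a ∈ xs
nth⇒∈ zero (x ∷ xs) refl = here refl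
nth⇒∈ (suc k) (x ∷ xs) eq = there (nth⇒∈ k xs eq)

All-nth : ∀ {A : Set} {P : A → Set} k xs {a} → All P xs → nth k xs ≡ just a → P a
All-nth k xs all eq = All.lookup all (nth⇒∈ k xs eq)

nth-suc⇒nth : ∀ {A : Set} k (xs : List A) {a} → nth (suc k) xs ≡ just a → Σ[ b ∈ A ] nth k xs ≡ just b
nth-suc⇒nth zero (x ∷ y ∷ xs) _ = x , refl
nth-suc⇒nth (suc k) (x ∷ xs) eq = nth-suc⇒nth k xs eq

≡suc⇒≢ : ∀ {r r₀ : ℕ} → r ≡ suc r₀ → r₀ ≢ r
≡suc⇒≢ r≡ r₀≡r = 1+n≢n (trans (sym r≡) (sym r₀≡r))

nth-++-∷-inv : ∀ {A : Set} (xs : List A) y ys r {a} → nth r (xs ++ y ∷ ys) ≡ just a →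
               (r ≡ length xs × a ≡ y) ⊎ a ∈ xs ++ ys
nth-++-∷-inv [] y ys zero refl = inj₁ (refl , refl)
nth-++-∷-inv [] y ys (suc r) eq = inj₂ (nth⇒∈ r ys eq)
nth-++-∷-inv (x ∷ xs) y ys zero refl = inj₂ (here refl)
nth-++-∷-inv (x ∷ xs) y ys (suc r) eq with nth-++-∷-inv xs y ys r eq
... | inj₁ (r≡ , a≡) = inj₁ (cong suc r≡ , a≡)
... | inj₂ a∈ = inj₂ (there a∈)

nth-++-∷-∷-inv : ∀ {A : Set} (xs : List A) y z ys r {a} → nth r (xs ++ y ∷ z ∷ ys) ≡ just a →
                 (r ≡ length xs × a ≡ y) ⊎ (r ≡ suc (length xs) × a ≡ z) ⊎ a ∈ xs ++ ys
nth-++-∷-∷-inv [] y z ys zero refl = inj₁ (refl , refl)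
nth-++-∷-∷-inv [] y z ys (suc zero) refl = inj₂ (inj₁ (refl , refl))
nth-++-∷-∷-inv [] y z ys (suc (suc r)) eq = inj₂ (inj₂ (nth⇒∈ r ys eq))
nth-++-∷-∷-inv (x ∷ xs) y z ys zero refl = inj₂ (inj₂ (here refl))
nth-++-∷-∷-inv (x ∷ xs) y z ys (suc r) eq with nth-++-∷-∷-inv xs y z ys r eq
... | inj₁ (r≡ , a≡) = inj₁ (cong suc r≡ , a≡)
... | inj₂ (inj₁ (r≡ , a≡)) = inj₂ (inj₁ (cong suc r≡ , a≡))
... | inj₂ (inj₂ a∈) = inj₂ (inj₂ (there a∈))

nth⇒<length : ∀ {A : Set} r (xs : List A) {a} → nth r xs ≡ just a → r < length xs
nth⇒<length zero (x ∷ xs) _ = s≤s z≤n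
nth⇒<length (suc r) (x ∷ xs) eq = s≤s (nth⇒<length r xs eq)

<length⇒nth : ∀ {A : Set} r (xs : List A) → r < length xs → Σ[ a ∈ A ] nth r xs ≡ just a
<length⇒nth zero (x ∷ xs) _ = x , refl
<length⇒nth (suc r) (x ∷ xs) (s≤s r<) = <length⇒nth r xs r<

nth-map : ∀ {A B : Set} (f : A → B) k xs → nth k (map f xs) ≡ Maybe.map f (nth k xs)
nth-map f k [] = refl
nth-map f zero (x ∷ xs) = refl
nth-map f (suc k) (x ∷ xs) = nth-map f k xs

split-last : ∀ {A : Set} (xs : List A) k → length xs ≡ suc k →
             Σ[ ys ∈ List A ] Σ[ y ∈ A ] xs ≡ ys ++ y ∷ [] × length ys ≡ k
split-last (x ∷ []) zero refl = [] , x , refl , refl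
split-last (x ∷ x′ ∷ xs) (suc k) eq with split-last (x′ ∷ xs) k (suc-injective eq)
... | ys , y , eq′ , refl = x ∷ ys , y , cong (x ∷_) eq′ , refl

modifyAt-++-∷ : ∀ {A : Set} (g : A → A) xs y ys r → length xs ≡ r →
                modifyAt r g (xs ++ y ∷ ys) ≡ xs ++ g y ∷ ys
modifyAt-++-∷ g [] y ys zero refl = refl
modifyAt-++-∷ g (x ∷ xs) y ys (suc r) refl = cong (x ∷_) (modifyAt-++-∷ g xs y ys r refl)

modifyAt-suc-++-∷-∷ : ∀ {A : Set} (g : A → A) xs y z ys r → length xs ≡ r →
                      modifyAt (suc r) g (xs ++ y ∷ z ∷ ys) ≡ xs ++ y ∷ g z ∷ ys
modifyAt-suc-++-∷-∷ g [] y z ys zero refl = refl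
modifyAt-suc-++-∷-∷ g (x ∷ xs) y z ys (suc r) refl = cong (x ∷_) (modifyAt-suc-++-∷-∷ g xs y z ys r refl)

nth-modifyAt-same : ∀ {A : Set} (g : A → A) k xs → nth k (modifyAt k g xs) ≡ Maybe.map g (nth k xs)
nth-modifyAt-same g k [] = refl
nth-modifyAt-same g zero (x ∷ xs) = refl
nth-modifyAt-same g (suc k) (x ∷ xs) = nth-modifyAt-same g k xs

nth-modifyAt-other : ∀ {A : Set} (g : A → A) k k′ xs → k′ ≢ k → nth k′ (modifyAt k g xs) ≡ nth k′ xs
nth-modifyAt-other g k k′ [] _ = refl
nth-modifyAt-other g zero zero (x ∷ xs) k′≢k = ⊥-elim (k′≢k refl)
nth-modifyAt-other g zero (suc k′) (x ∷ xs) _ = refl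
nth-modifyAt-other g (suc k) zero (x ∷ xs) _ = refl
nth-modifyAt-other g (suc k) (suc k′) (x ∷ xs) k′≢k = nth-modifyAt-other g k k′ xs (k′≢k ∘ cong suc)

length-modifyAt : ∀ {A : Set} (g : A → A) k xs → length (modifyAt k g xs) ≡ length xs
length-modifyAt g k [] = refl
length-modifyAt g zero (x ∷ xs) = refl
length-modifyAt g (suc k) (x ∷ xs) = cong suc (length-modifyAt g k xs)

map-length-modifyAt : ∀ {A : Set} (h : List A → List A) → (∀ C → length (h C) ≡ length C) →
                      ∀ k T → map length (modifyAt k h T) ≡ map length T
map-length-modifyAt h h-length k [] = refl
map-length-modifyAt h h-length zero (C ∷ T) = cong (_∷ map length T) (h-length C)
map-length-modifyAt h h-length (suc k) (C ∷ T) = cong (length C ∷_) (map-length-modifyAt h h-length k T)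

All-modifyAt : ∀ {A : Set} {P : A → Set} (g : A → A) k xs → All P xs →
               (∀ x → nth k xs ≡ just x → P (g x)) → All P (modifyAt k g xs)
All-modifyAt g k [] _ _ = []
All-modifyAt g zero (x ∷ xs) (_ ∷ pxs) pgx = pgx x refl ∷ pxs
All-modifyAt g (suc k) (x ∷ xs) (px ∷ pxs) pgx = px ∷ All-modifyAt g k xs pxs pgx

boxAt≡ : ∀ T c r → boxAt T c r ≡ (nth c T >>= nth r)
boxAt≡ T c r with nth c T
... | nothing = refl
... | just C = refl

boxAt-nth : ∀ T c r {C} → nth c T ≡ just C → boxAt T c r ≡ nth r C
boxAt-nth T c r eq rewrite boxAt≡ T c r | eq = refl

boxAt⇒nth : ∀ T c r {B} → boxAt T c r ≡ just B → Σ[ C ∈ Column ] nth c T ≡ just C × nth r C ≡ just B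
boxAt⇒nth T c r eq with nth c T
... | just C = C , refl , eq

boxAt-++-∷ : ∀ Tpre C Tpost r → boxAt (Tpre ++ C ∷ Tpost) (length Tpre) r ≡ nth r C
boxAt-++-∷ Tpre C Tpost r = boxAt-nth (Tpre ++ C ∷ Tpost) (length Tpre) r (nth-++-∷ Tpre C Tpost _ refl)

modifyBox-++-∷ : ∀ g r Tpre C Tpost →
                 modifyBox (length Tpre) r g (Tpre ++ C ∷ Tpost) ≡ Tpre ++ modifyAt r g C ∷ Tpost
modifyBox-++-∷ g r Tpre C Tpost = modifyAt-++-∷ (modifyAt r g) Tpre C Tpost _ refl

boxAt-modifyBox-same : ∀ g c r T → boxAt (modifyBox c r g T) c r ≡ Maybe.map g (boxAt T c r)
boxAt-modifyBox-same g c r T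
  rewrite boxAt≡ (modifyBox c r g T) c r | boxAt≡ T c r | nth-modifyAt-same (modifyAt r g) c T
  with nth c T
... | nothing = refl
... | just C = nth-modifyAt-same g r C

boxAt-modifyBox-other : ∀ g c r T c′ r′ → c′ ≢ c ⊎ r′ ≢ r →
                        boxAt (modifyBox c r g T) c′ r′ ≡ boxAt T c′ r′
boxAt-modifyBox-other g c r T c′ r′ elsewhere
  rewrite boxAt≡ (modifyBox c r g T) c′ r′ | boxAt≡ T c′ r′ with c′ ≟ c
... | no c′≢c rewrite nth-modifyAt-other (modifyAt r g) c c′ T c′≢c = refl
... | yes refl with elsewhere
...   | inj₁ c≢c = ⊥-elim (c≢c refl)
...   | inj₂ r′≢r rewrite nth-modifyAt-same (modifyAt r g) c T with nth c T
...     | nothing = refl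
...     | just C = nth-modifyAt-other g r r′ C r′≢r

nth-zero⇒∷ : ∀ {A : Set} (xs : List A) {a} → nth 0 xs ≡ just a → Σ[ xs′ ∈ List A ] xs ≡ a ∷ xs′
nth-zero⇒∷ (x ∷ xs) refl = xs , refl

-- Tableaux

columnLength : List ℕ → ℕ → ℕ
columnLength λ′ j = length (filter (λ a → j <? a) λ′)

columnLength-antitone : ∀ λ′ j → columnLength λ′ (suc j) ≤ columnLength λ′ j
columnLength-antitone [] j = z≤n
columnLength-antitone (a ∷ λ′) j with suc j <ᵇ a in 1+j<ᵇa | j <ᵇ a in j<ᵇa
... | true | true = s≤s (columnLength-antitone λ′ j)
... | true | false =
  ⊥-elim (subst True j<ᵇa (<⇒<ᵇ (<-trans (n<1+n j) (<ᵇ⇒< (suc j) a (subst True (sym 1+j<ᵇa) tt)))))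
... | false | true = m≤n⇒m≤1+n (columnLength-antitone λ′ j)
... | false | false = columnLength-antitone λ′ j

nth-applyUpTo : ∀ (g : ℕ → ℕ) m k {v} → nth k (applyUpTo g m) ≡ just v → v ≡ g k
nth-applyUpTo g (suc m) zero refl = refl
nth-applyUpTo g (suc m) (suc k) eq = nth-applyUpTo (g ∘ suc) m k eq

length-column : ∀ {n λ′ T} c {C} → IsMVT n λ′ T → nth c T ≡ just C → length C ≡ columnLength λ′ c
length-column {λ′ = λ′} {T} c {C} mvt eq = nth-applyUpTo (columnLength λ′) (foldr _⊔_ 0 λ′) c lengths
  where
  lengths : nth c (applyUpTo (columnLength λ′) (foldr _⊔_ 0 λ′)) ≡ just (length C)
  lengths = begin
    nth c (applyUpTo (columnLength λ′) (foldr _⊔_ 0 λ′))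
      ≡⟨ cong (nth c) (sym (trans (IsMVT.shape mvt) (map-upTo (columnLength λ′) (foldr _⊔_ 0 λ′)))) ⟩
    nth c (map length T)                   ≡⟨ nth-map length c T ⟩
    Maybe.map length (nth c T)             ≡⟨ cong (Maybe.map length) eq ⟩
    just (length C)                        ∎
    where open ≡-Reasoning

boxAt-left : ∀ {n λ′ T} c r {R} → IsMVT n λ′ T → boxAt T (suc c) r ≡ just R →
             Σ[ L ∈ Box ] boxAt T c r ≡ just L
boxAt-left {λ′ = λ′} {T} c r mvt eq with boxAt⇒nth T (suc c) r eq
... | C′ , C′≡ , R≡ with nth-suc⇒nth c T C′≡
...   | C , C≡ with <length⇒nth r C r<
  where
  r< : r < length C
  r< = begin-strict
    r                       <⟨ nth⇒<length r C′ R≡ ⟩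
    length C′               ≡⟨ length-column (suc c) mvt C′≡ ⟩
    columnLength λ′ (suc c) ≤⟨ columnLength-antitone λ′ c ⟩
    columnLength λ′ c       ≡⟨ sym (length-column c mvt C≡) ⟩
    length C                ∎
    where open ≤-Reasoning
...     | L , L≡ = L , trans (boxAt-nth T c r C≡) L≡

isBox-removeOne : ∀ {n} k X → IsBox n X → k ∈ removeOne k X → IsBox n (removeOne k X)
isBox-removeOne k X (_ , sorted , bounds) k∈ =
  ∈⇒≢[] k∈ , removeOne-sorted k X sorted , All-removeOne k X bounds

isBox-insertM : ∀ {n} k X → Linked _≤_ X → All (λ x → 1 ≤ x × x ≤ n) X → 1 ≤ k → k ≤ n →
                IsBox n (insertM k X)
isBox-insertM k X sorted bounds 1≤k k≤n =
  insertM-nonempty k X , insertM-sorted k X sorted , All-insertM k X (1≤k , k≤n) bounds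

record FitsAt (T : Tableau) (c r : ℕ) (Y : Box) : Set where
  field
    above : ∀ {r′ A} → r ≡ suc r′ → boxAt T c r′ ≡ just A → All (maxL A <_) Y
    below : ∀ {D} → boxAt T c (suc r) ≡ just D → All (_< minL D) Y
    left : ∀ {c′ L} → c ≡ suc c′ → boxAt T c′ r ≡ just L → All (maxL L ≤_) Y
    right : ∀ {R} → boxAt T (suc c) r ≡ just R → All (_≤ minL R) Y

column-isBoxes : ∀ {n λ′ T} c {C} → IsMVT n λ′ T → nth c T ≡ just C → All (IsBox n) C
column-isBoxes {T = T} c mvt C≡ = All-nth c T (IsMVT.boxes mvt) C≡

nth-isBox : ∀ {n λ′ T} c {C} r {B} → IsMVT n λ′ T → nth c T ≡ just C → nth r C ≡ just B → IsBox n B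
nth-isBox c {C} r mvt C≡ B≡ = All-nth r C (column-isBoxes c mvt C≡) B≡

boxAt-isBox : ∀ {n λ′ T} c r {B} → IsMVT n λ′ T → boxAt T c r ≡ just B → IsBox n B
boxAt-isBox {T = T} c r mvt eq with boxAt⇒nth T c r eq
... | C , C≡ , B≡ = nth-isBox c r mvt C≡ B≡

isMVT-fitsAt : ∀ {n λ′ T c r X} → IsMVT n λ′ T → boxAt T c r ≡ just X → FitsAt T c r X
isMVT-fitsAt {X = X} mvt X≡ = record
  { above = λ { refl A≡ → All.map (<-≤-trans (IsMVT.colCond mvt _ _ _ X A≡ X≡)) (All-minL-≤ X) }
  ; below = λ D≡ → All.map (λ x≤ → ≤-<-trans x≤ (IsMVT.colCond mvt _ _ X _ X≡ D≡)) (All-≤-maxL X)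
  ; left = λ { refl L≡ → All.map (≤-trans (IsMVT.rowCond mvt _ _ _ X L≡ X≡)) (All-minL-≤ X) }
  ; right = λ R≡ → All.map (λ x≤ → ≤-trans x≤ (IsMVT.rowCond mvt _ _ X _ X≡ R≡)) (All-≤-maxL X)
  }

fitsAt-sub : ∀ {T c r X Y} → FitsAt T c r X → (∀ {P : ℕ → Set} → All P X → All P Y) → FitsAt T c r Y
fitsAt-sub fits X⊇Y = record
  { above = λ r≡ A≡ → X⊇Y (FitsAt.above fits r≡ A≡)
  ; below = λ D≡ → X⊇Y (FitsAt.below fits D≡)
  ; left = λ c≡ L≡ → X⊇Y (FitsAt.left fits c≡ L≡)
  ; right = λ R≡ → X⊇Y (FitsAt.right fits R≡)
  }

maxL<-All : ∀ {k} B → B ≢ [] → All (_< k) B → maxL B < k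
maxL<-All B B≢[] all = All.lookup all (maxL∈ B B≢[])

maxL≤-All : ∀ {k} B → B ≢ [] → All (_≤ k) B → maxL B ≤ k
maxL≤-All B B≢[] all = All.lookup all (maxL∈ B B≢[])

<minL-All : ∀ {k} B → B ≢ [] → All (k <_) B → k < minL B
<minL-All B B≢[] all = All.lookup all (minL∈ B B≢[])

≤minL-All : ∀ {k} B → B ≢ [] → All (k ≤_) B → k ≤ minL B
≤minL-All B B≢[] all = All.lookup all (minL∈ B B≢[])

modifyBox-isMVT : ∀ {n λ′ T c r X} (g : Box → Box) → IsMVT n λ′ T → boxAt T c r ≡ just X →
                  IsBox n (g X) → FitsAt T c r (g X) → IsMVT n λ′ (modifyBox c r g T)
modifyBox-isMVT {n} {λ′} {T} {c} {r} {X} g mvt X≡ gX-box fits = record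
  { shape = trans (map-length-modifyAt (modifyAt r g) (length-modifyAt g r) c T) (IsMVT.shape mvt)
  ; boxes = All-modifyAt (modifyAt r g) c T (IsMVT.boxes mvt) λ C C≡ →
      All-modifyAt g r C (column-isBoxes c mvt C≡) λ B B≡ →
        subst (IsBox n ∘ g) (just-injective (trans (sym X≡) (trans (boxAt-nth T c r C≡) B≡))) gX-box
  ; rowCond = row
  ; colCond = col
  }
  where
  T′ = modifyBox c r g T
  gX≢[] = proj₁ gX-box
  old : ∀ {c′ r′} → c′ ≢ c ⊎ r′ ≢ r → boxAt T′ c′ r′ ≡ boxAt T c′ r′
  old = boxAt-modifyBox-other g c r T _ _
  new : ∀ {A} → boxAt T′ c r ≡ just A → A ≡ g X
  new A≡ = just-injective (trans (sym A≡) (trans (boxAt-modifyBox-same g c r T) (cong (Maybe.map g) X≡)))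
  row : ∀ c₁ r₁ A B → boxAt T′ c₁ r₁ ≡ just A → boxAt T′ (suc c₁) r₁ ≡ just B → maxL A ≤ minL B
  row c₁ r₁ A B A≡ B≡ with c₁ ≟ c | suc c₁ ≟ c | r₁ ≟ r
  ... | _ | _ | no r₁≢r =
    IsMVT.rowCond mvt c₁ r₁ A B (trans (sym (old (inj₂ r₁≢r))) A≡) (trans (sym (old (inj₂ r₁≢r))) B≡)
  ... | yes refl | _ | yes refl rewrite new A≡ =
    maxL≤-All (g X) gX≢[] (FitsAt.right fits (trans (sym (old (inj₁ 1+n≢n))) B≡))
  ... | no c₁≢c | yes refl | yes refl rewrite new B≡ =
    ≤minL-All (g X) gX≢[] (FitsAt.left fits refl (trans (sym (old (inj₁ c₁≢c))) A≡))
  ... | no c₁≢c | no 1+c₁≢c | yes refl =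
    IsMVT.rowCond mvt c₁ r₁ A B (trans (sym (old (inj₁ c₁≢c))) A≡) (trans (sym (old (inj₁ 1+c₁≢c))) B≡)
  col : ∀ c₁ r₁ A D → boxAt T′ c₁ r₁ ≡ just A → boxAt T′ c₁ (suc r₁) ≡ just D → maxL A < minL D
  col c₁ r₁ A D A≡ D≡ with c₁ ≟ c | r₁ ≟ r | suc r₁ ≟ r
  ... | no c₁≢c | _ | _ =
    IsMVT.colCond mvt c₁ r₁ A D (trans (sym (old (inj₁ c₁≢c))) A≡) (trans (sym (old (inj₁ c₁≢c))) D≡)
  ... | yes refl | yes refl | _ rewrite new A≡ =
    maxL<-All (g X) gX≢[] (FitsAt.below fits (trans (sym (old (inj₂ 1+n≢n))) D≡))
  ... | yes refl | no r₁≢r | yes refl rewrite new D≡ =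
    <minL-All (g X) gX≢[] (FitsAt.above fits refl (trans (sym (old (inj₂ r₁≢r))) A≡))
  ... | yes refl | no r₁≢r | no 1+r₁≢r =
    IsMVT.colCond mvt c₁ r₁ A D (trans (sym (old (inj₂ r₁≢r))) A≡) (trans (sym (old (inj₂ 1+r₁≢r))) D≡)

modifyBox-isMVT-sub : ∀ {n λ′ T c r X} (g : Box → Box) → IsMVT n λ′ T → boxAt T c r ≡ just X →
                      IsBox n (g X) → (∀ {P : ℕ → Set} → All P X → All P (g X)) →
                      IsMVT n λ′ (modifyBox c r g T)
modifyBox-isMVT-sub g mvt X≡ gX-box X⊇gX = modifyBox-isMVT g mvt X≡ gX-box (fitsAt-sub (isMVT-fitsAt mvt X≡) X⊇gX)

_≺_ : Box → Box → Set
A ≺ D = maxL A < minL D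

column-strict : ∀ {n λ′ T} c {C} → IsMVT n λ′ T → nth c T ≡ just C → Linked _≺_ C
column-strict {T = T} c {C} mvt C≡ =
  linked C (λ r A≡ D≡ → IsMVT.colCond mvt c r _ _ (entry r A≡) (entry (suc r) D≡))
  where
  entry : ∀ r {B} → nth r C ≡ just B → boxAt T c r ≡ just B
  entry r B≡ = trans (boxAt-nth T c r C≡) B≡
  linked : ∀ C → (∀ r {A D} → nth r C ≡ just A → nth (suc r) C ≡ just D → A ≺ D) → Linked _≺_ C
  linked [] _ = []
  linked (A ∷ []) _ = [-]
  linked (A ∷ D ∷ C) adjacent = adjacent 0 refl refl ∷ linked (D ∷ C) (λ r → adjacent (suc r))

strictly-below : ∀ {n B C} → All (IsBox n) C → Linked _≺_ (B ∷ C) → All (All (maxL B <_)) C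
strictly-below [] _ = []
strictly-below {B = B} {D ∷ C} (D-box ∷ C-boxes) (B≺D ∷ strict) =
  All.map (<-≤-trans B≺D) (All-minL-≤ D) ∷
  All.map (All.map (<-trans (<-≤-trans B≺D (minL≤maxL D (proj₁ D-box))))) (strictly-below {B = D} C-boxes strict)

-- The i-signature word of a tableau

column : SLetter → ℕ
column (_ , c , _) = c

module Word (i : ℕ) where

  signs : List Letter → List SLetter
  signs = concatMap (signOf i)

  boxSigns : ℕ → ℕ → List ℕ → List SLetter
  boxSigns c r xs = signs (map (λ x → x , c , r) xs)

  rowsSigns : (Box → List ℕ) → ℕ → ℕ → Column → List SLetter
  rowsSigns h c r [] = []
  rowsSigns h c r (B ∷ C) = boxSigns c r (h B) ++ rowsSigns h c (suc r) C

  columnWord : ℕ → Column → List SLetter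
  columnWord c C = signs (rdCol c C)

  wordFrom : ℕ → Tableau → List SLetter
  wordFrom k [] = []
  wordFrom k (C ∷ T) = columnWord k C ++ wordFrom (suc k) T

  signs-concatMap : ∀ {A : Set} (g : A → List Letter) (w : A → List SLetter) → (∀ a → signs (g a) ≡ w a) →
                    ∀ xs → signs (concatMap g xs) ≡ concatMap w xs
  signs-concatMap g w g≗ [] = refl
  signs-concatMap g w g≗ (x ∷ xs) =
    trans (concatMap-++ (signOf i) (g x) _) (cong₂ _++_ (g≗ x) (signs-concatMap g w g≗ xs))

  concatMap-indexedFrom-columns : ∀ k T →
    concatMap (λ { (c , C) → columnWord c C }) (indexedFrom k T) ≡ wordFrom k T
  concatMap-indexedFrom-columns k [] = refl
  concatMap-indexedFrom-columns k (C ∷ T) = cong (columnWord k C ++_) (concatMap-indexedFrom-columns (suc k) T)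

  concatMap-indexedFrom-rows : ∀ h c k C →
    concatMap (λ { (r , B) → boxSigns c r (h B) }) (indexedFrom k C) ≡ rowsSigns h c k C
  concatMap-indexedFrom-rows h c k [] = refl
  concatMap-indexedFrom-rows h c k (B ∷ C) = cong (boxSigns c k (h B) ++_) (concatMap-indexedFrom-rows h c (suc k) C)

  signature≡reduced-wordFrom : ∀ T → signature i T ≡ reduced (wordFrom 0 T)
  signature≡reduced-wordFrom T = begin
    signature i T
      ≡⟨ reduceSig≡reduced (signs (rd T)) ⟩
    reduced (signs (rd T))
      ≡⟨ cong (reduced ∘ signs ∘ concatMap _) (indexed≡indexedFrom0 T) ⟩
    reduced (signs (concatMap _ (indexedFrom 0 T)))
      ≡⟨ cong reduced (signs-concatMap _ _ (λ _ → refl) (indexedFrom 0 T)) ⟩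
    reduced (concatMap _ (indexedFrom 0 T))
      ≡⟨ cong reduced (concatMap-indexedFrom-columns 0 T) ⟩
    reduced (wordFrom 0 T) ∎
    where open ≡-Reasoning

  signOf-reverse : ∀ l → reverse (signOf i l) ≡ signOf i l
  signOf-reverse (x , c , r) with x ≡ᵇ i
  ... | true = refl
  ... | false with x ≡ᵇ suc i
  ...   | true = refl
  ...   | false = refl

  signs-reverse : ∀ xs → signs (reverse xs) ≡ reverse (signs xs)
  signs-reverse [] = refl
  signs-reverse (x ∷ xs) = begin
    signs (reverse (x ∷ xs))                   ≡⟨ cong signs (unfold-reverse x xs) ⟩
    signs (reverse xs ++ x ∷ [])               ≡⟨ concatMap-++ (signOf i) (reverse xs) (x ∷ []) ⟩
    signs (reverse xs) ++ signOf i x ++ []     ≡⟨ cong₂ _++_ (signs-reverse xs) (++-identityʳ _) ⟩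
    reverse (signs xs) ++ signOf i x           ≡⟨ cong (reverse (signs xs) ++_) (sym (signOf-reverse x)) ⟩
    reverse (signs xs) ++ reverse (signOf i x) ≡⟨ sym (reverse-++ (signOf i x) (signs xs)) ⟩
    reverse (signs (x ∷ xs))                   ∎
    where open ≡-Reasoning

  columnWord≡ : ∀ c C → columnWord c C ≡ reverse (rowsSigns headL c 0 C) ++ rowsSigns (drop 1) c 0 C
  columnWord≡ c C = begin
    signs (reverse (concatMap heads (indexed C)) ++ concatMap tails (indexed C))
      ≡⟨ concatMap-++ (signOf i) (reverse (concatMap heads (indexed C))) _ ⟩
    signs (reverse (concatMap heads (indexed C))) ++ signs (concatMap tails (indexed C))
      ≡⟨ cong (_++ signs (concatMap tails (indexed C))) (signs-reverse (concatMap heads (indexed C))) ⟩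
    reverse (signs (concatMap heads (indexed C))) ++ signs (concatMap tails (indexed C))
      ≡⟨ cong₂ (λ hs ts → reverse hs ++ ts) (rows headL heads (λ _ _ → refl))
                                            (rows (drop 1) tails (λ _ _ → refl)) ⟩
    reverse (rowsSigns headL c 0 C) ++ rowsSigns (drop 1) c 0 C ∎
    where
    open ≡-Reasoning
    heads tails : ℕ × Box → List Letter
    heads (r , B) = map (λ x → x , c , r) (headL B)
    tails (r , B) = map (λ x → x , c , r) (drop 1 B)
    rows : ∀ h (g : ℕ × Box → List Letter) → (∀ r B → g (r , B) ≡ map (λ x → x , c , r) (h B)) →
           signs (concatMap g (indexed C)) ≡ rowsSigns h c 0 C
    rows h g g≡ = begin
      signs (concatMap g (indexed C))
        ≡⟨ cong (signs ∘ concatMap g) (indexed≡indexedFrom0 C) ⟩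
      signs (concatMap g (indexedFrom 0 C))
        ≡⟨ signs-concatMap g _ (λ { (r , B) → cong signs (g≡ r B) }) (indexedFrom 0 C) ⟩
      concatMap (λ { (r , B) → boxSigns c r (h B) }) (indexedFrom 0 C)
        ≡⟨ concatMap-indexedFrom-rows h c 0 C ⟩
      rowsSigns h c 0 C ∎

  wordFrom-++-∷ : ∀ k Tpre C Tpost →
    wordFrom k (Tpre ++ C ∷ Tpost) ≡
    wordFrom k Tpre ++ columnWord (k + length Tpre) C ++ wordFrom (suc (k + length Tpre)) Tpost
  wordFrom-++-∷ k [] C Tpost rewrite +-identityʳ k = refl
  wordFrom-++-∷ k (D ∷ Tpre) C Tpost rewrite wordFrom-++-∷ (suc k) Tpre C Tpost | +-suc k (length Tpre) =
    sym (++-assoc (columnWord k D) (wordFrom (suc k) Tpre) _)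

  signOf-column : ∀ x c r → All (λ s → column s ≡ c) (signOf i (x , c , r))
  signOf-column x c r with x ≡ᵇ i
  ... | true = refl ∷ []
  ... | false with x ≡ᵇ suc i
  ...   | true = refl ∷ []
  ...   | false = []

  boxSigns-column : ∀ c r xs → All (λ s → column s ≡ c) (boxSigns c r xs)
  boxSigns-column c r [] = []
  boxSigns-column c r (x ∷ xs) = All.++⁺ (signOf-column x c r) (boxSigns-column c r xs)

  rowsSigns-column : ∀ h c r C → All (λ s → column s ≡ c) (rowsSigns h c r C)
  rowsSigns-column h c r [] = []
  rowsSigns-column h c r (B ∷ C) = All.++⁺ (boxSigns-column c r (h B)) (rowsSigns-column h c (suc r) C)

  columnWord-column : ∀ c C → All (λ s → column s ≡ c) (columnWord c C)
  columnWord-column c C rewrite columnWord≡ c C =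
    All.++⁺ (All-reverse _ (rowsSigns-column headL c 0 C)) (rowsSigns-column (drop 1) c 0 C)

  ++-≡-++-∷ : ∀ {A : Set} (a b u v : List A) l → a ++ b ≡ u ++ l ∷ v →
              (Σ[ y ∈ List A ] a ≡ u ++ l ∷ y × v ≡ y ++ b) ⊎
              (Σ[ x ∈ List A ] u ≡ a ++ x × b ≡ x ++ l ∷ v)
  ++-≡-++-∷ [] b u v l eq = inj₂ (u , refl , eq)
  ++-≡-++-∷ (z ∷ a) b [] v l eq with ∷-injective eq
  ... | refl , eq′ = inj₁ (a , refl , sym eq′)
  ++-≡-++-∷ (z ∷ a) b (w ∷ u) v l eq with ∷-injective eq
  ... | refl , eq′ with ++-≡-++-∷ a b u v l eq′
  ...   | inj₁ (y , a≡ , v≡) = inj₁ (y , cong (z ∷_) a≡ , v≡)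
  ...   | inj₂ (x , u≡ , b≡) = inj₂ (x , cong (z ∷_) u≡ , b≡)

  record LetterInColumn (k : ℕ) (T : Tableau) (u : List SLetter) (l : SLetter) (v : List SLetter) : Set where
    constructor inColumn
    field
      Tpre : Tableau
      C : Column
      Tpost : Tableau
      x y : List SLetter
      T≡ : T ≡ Tpre ++ C ∷ Tpost
      column≡ : k + length Tpre ≡ column l
      u≡ : u ≡ wordFrom k Tpre ++ x
      columnWord≡x++l∷y : columnWord (column l) C ≡ x ++ l ∷ y
      v≡ : v ≡ y ++ wordFrom (suc (column l)) Tpost

  locateLetter : ∀ k T u l v → wordFrom k T ≡ u ++ l ∷ v → LetterInColumn k T u l v
  locateLetter k [] [] l v ()
  locateLetter k [] (_ ∷ _) l v ()
  locateLetter k (C ∷ T) u l v eq with ++-≡-++-∷ (columnWord k C) (wordFrom (suc k) T) u v l eq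
  ... | inj₁ (y , C≡ , v≡) with All.head (All.++⁻ʳ u (subst (All _) C≡ (columnWord-column k C)))
  ...   | refl = inColumn [] C T u y refl (+-identityʳ k) refl C≡ v≡
  locateLetter k (C ∷ T) u l v eq | inj₂ (x′ , u≡ , T≡) with locateLetter (suc k) T x′ l v T≡
  ... | inColumn Tpre C′ Tpost x y refl col≡ refl C′≡ v≡ =
    inColumn (C ∷ Tpre) C′ Tpost x y refl (trans (+-suc k (length Tpre)) col≡)
      (trans u≡ (sym (++-assoc (columnWord k C) (wordFrom (suc k) Tpre) x))) C′≡ v≡

  Neutral : ℕ → Set
  Neutral x = x ≢ i × x ≢ suc i

  NeutralBox : Box → Set
  NeutralBox = All Neutral

  NeutralColumn : Column → Set
  NeutralColumn = All NeutralBox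

  signOf-neutral : ∀ x c r → Neutral x → signOf i (x , c , r) ≡ []
  signOf-neutral x c r (x≢i , x≢1+i) rewrite ≡ᵇ-false x i x≢i | ≡ᵇ-false x (suc i) x≢1+i = refl

  signOf-i : ∀ c r → signOf i (i , c , r) ≡ (plus , c , r) ∷ []
  signOf-i c r rewrite ≡ᵇ-refl i = refl

  signOf-1+i : ∀ c r → signOf i (suc i , c , r) ≡ (minus , c , r) ∷ []
  signOf-1+i c r rewrite ≡ᵇ-false (suc i) i (λ ()) | ≡ᵇ-refl i = refl

  boxSigns-neutral : ∀ c r xs → NeutralBox xs → boxSigns c r xs ≡ []
  boxSigns-neutral c r [] _ = refl
  boxSigns-neutral c r (x ∷ xs) (nx ∷ nxs) rewrite signOf-neutral x c r nx = boxSigns-neutral c r xs nxs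

  PreservesNeutral : (Box → List ℕ) → Set
  PreservesNeutral h = ∀ B → NeutralBox B → NeutralBox (h B)

  headL-sublist : PreservesNeutral headL
  headL-sublist [] _ = []
  headL-sublist (x ∷ B) (nx ∷ _) = nx ∷ []

  drop1-sublist : PreservesNeutral (drop 1)
  drop1-sublist [] _ = []
  drop1-sublist (x ∷ B) (_ ∷ nB) = nB

  rowsSigns-neutral : ∀ h → PreservesNeutral h → ∀ c r C → NeutralColumn C → rowsSigns h c r C ≡ []
  rowsSigns-neutral h h⊆ c r [] _ = refl
  rowsSigns-neutral h h⊆ c r (B ∷ C) (nB ∷ nC) rewrite boxSigns-neutral c r (h B) (h⊆ B nB) =
    rowsSigns-neutral h h⊆ c (suc r) C nC

  rowsSigns-++-∷ : ∀ h c r C₁ X C₂ → rowsSigns h c r (C₁ ++ X ∷ C₂) ≡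
    rowsSigns h c r C₁ ++ boxSigns c (r + length C₁) (h X) ++ rowsSigns h c (suc (r + length C₁)) C₂
  rowsSigns-++-∷ h c r [] X C₂ rewrite +-identityʳ r = refl
  rowsSigns-++-∷ h c r (B ∷ C₁) X C₂ rewrite rowsSigns-++-∷ h c (suc r) C₁ X C₂ | +-suc r (length C₁) =
    sym (++-assoc (boxSigns c r (h B)) (rowsSigns h c (suc r) C₁) _)

  rowsSigns-single : ∀ h → PreservesNeutral h → ∀ c C₁ X C₂ → NeutralColumn C₁ → NeutralColumn C₂ →
                     rowsSigns h c 0 (C₁ ++ X ∷ C₂) ≡ boxSigns c (length C₁) (h X)
  rowsSigns-single h h⊆ c C₁ X C₂ n₁ n₂
    rewrite rowsSigns-++-∷ h c 0 C₁ X C₂ | rowsSigns-neutral h h⊆ c 0 C₁ n₁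
          | rowsSigns-neutral h h⊆ c (suc (length C₁)) C₂ n₂ = ++-identityʳ _

  rowsSigns-pair : ∀ h → PreservesNeutral h → ∀ c C₁ U L C₂ → NeutralColumn C₁ → NeutralColumn C₂ →
    rowsSigns h c 0 (C₁ ++ U ∷ L ∷ C₂) ≡ boxSigns c (length C₁) (h U) ++ boxSigns c (suc (length C₁)) (h L)
  rowsSigns-pair h h⊆ c C₁ U L C₂ n₁ n₂
    rewrite rowsSigns-++-∷ h c 0 C₁ U (L ∷ C₂) | rowsSigns-neutral h h⊆ c 0 C₁ n₁
          | rowsSigns-neutral h h⊆ c (suc (suc (length C₁))) C₂ n₂ =
    cong (boxSigns c (length C₁) (h U) ++_) (++-identityʳ _)

  boxSigns-headL-reverse : ∀ c r X → reverse (boxSigns c r (headL X)) ≡ boxSigns c r (headL X)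
  boxSigns-headL-reverse c r [] = refl
  boxSigns-headL-reverse c r (x ∷ X) =
    trans (cong reverse (++-identityʳ (signOf i (x , c , r))))
          (trans (signOf-reverse (x , c , r)) (sym (++-identityʳ _)))

  boxSigns-headL-drop1 : ∀ c r X → boxSigns c r (headL X) ++ boxSigns c r (drop 1 X) ≡ boxSigns c r X
  boxSigns-headL-drop1 c r [] = refl
  boxSigns-headL-drop1 c r (x ∷ X) = cong (_++ boxSigns c r X) (++-identityʳ (signOf i (x , c , r)))

  columnWord-neutral : ∀ c C → NeutralColumn C → columnWord c C ≡ []
  columnWord-neutral c C nC
    rewrite columnWord≡ c C | rowsSigns-neutral headL headL-sublist c 0 C nC
          | rowsSigns-neutral (drop 1) drop1-sublist c 0 C nC = refl

  columnWord-single : ∀ c C₁ X C₂ → NeutralColumn C₁ → NeutralColumn C₂ →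
                      columnWord c (C₁ ++ X ∷ C₂) ≡ boxSigns c (length C₁) X
  columnWord-single c C₁ X C₂ n₁ n₂
    rewrite columnWord≡ c (C₁ ++ X ∷ C₂) | rowsSigns-single headL headL-sublist c C₁ X C₂ n₁ n₂
          | rowsSigns-single (drop 1) drop1-sublist c C₁ X C₂ n₁ n₂ | boxSigns-headL-reverse c (length C₁) X =
    boxSigns-headL-drop1 c (length C₁) X

  columnWord-pair : ∀ c C₁ U L C₂ → NeutralColumn C₁ → NeutralColumn C₂ →
    columnWord c (C₁ ++ U ∷ L ∷ C₂) ≡
    boxSigns c (suc (length C₁)) (headL L) ++ boxSigns c (length C₁) U ++ boxSigns c (suc (length C₁)) (drop 1 L)
  columnWord-pair c C₁ U L C₂ n₁ n₂
    rewrite columnWord≡ c (C₁ ++ U ∷ L ∷ C₂) | rowsSigns-pair headL headL-sublist c C₁ U L C₂ n₁ n₂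
          | rowsSigns-pair (drop 1) drop1-sublist c C₁ U L C₂ n₁ n₂
          | reverse-++ (boxSigns c (length C₁) (headL U)) (boxSigns c (suc (length C₁)) (headL L))
          | boxSigns-headL-reverse c (length C₁) U | boxSigns-headL-reverse c (suc (length C₁)) L = begin
      (hL ++ hU) ++ tU ++ tL ≡⟨ ++-assoc hL hU _ ⟩
      hL ++ hU ++ tU ++ tL   ≡⟨ cong (hL ++_) (sym (++-assoc hU tU tL)) ⟩
      hL ++ (hU ++ tU) ++ tL ≡⟨ cong (λ w → hL ++ w ++ tL) (boxSigns-headL-drop1 c r U) ⟩
      hL ++ boxSigns c r U ++ tL ∎
    where
    open ≡-Reasoning
    r = length C₁
    hL = boxSigns c (suc r) (headL L)
    hU = boxSigns c r (headL U)
    tU = boxSigns c r (drop 1 U)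
    tL = boxSigns c (suc r) (drop 1 L)

  boxSigns-sorted : ∀ c r X → Linked _≤_ X →
    boxSigns c r X ≡ replicate (multiplicity i X) (plus , c , r) ++ replicate (multiplicity (suc i) X) (minus , c , r)
  boxSigns-sorted c r [] _ = refl
  boxSigns-sorted c r (x ∷ X) sorted with x ≟ i
  ... | yes refl rewrite signOf-i c r | multiplicity-here i X | multiplicity-other (suc i) i X (λ ()) =
    cong ((plus , c , r) ∷_) (boxSigns-sorted c r X (Linked.tail sorted))
  ... | no x≢i with x ≟ suc i
  ...   | yes refl rewrite signOf-1+i c r | multiplicity-here (suc i) X | multiplicity-other i (suc i) X x≢i
          | boxSigns-sorted c r X (Linked.tail sorted)
          | multiplicity-absent i X
              (All.map (λ 1+i≤y y≡i → 1+n≰n (subst (suc i ≤_) y≡i 1+i≤y)) (linked-head-≤ sorted))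
          = refl
  ...   | no x≢1+i rewrite signOf-neutral x c r (x≢i , x≢1+i) | multiplicity-other i x X x≢i
          | multiplicity-other (suc i) x X x≢1+i = boxSigns-sorted c r X (Linked.tail sorted)

  record UnbracketedInColumn (T : Tableau) (l : SLetter) : Set where
    constructor unbracketedInColumn
    field
      Tpre : Tableau
      C : Column
      Tpost : Tableau
      x y : List SLetter
      T≡ : T ≡ Tpre ++ C ∷ Tpost
      column≡ : length Tpre ≡ column l
      columnWord≡x++l∷y : columnWord (column l) C ≡ x ++ l ∷ y
      before-plus : AllPlus (reduced (wordFrom 0 Tpre ++ x))
      after-minus : AllMinus (reduced (y ++ wordFrom (suc (column l)) Tpost))

  unbracketed⇒inColumn : ∀ T l → Unbracketed (wordFrom 0 T) l → UnbracketedInColumn T l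
  unbracketed⇒inColumn T l (unbracketed u v split ps ms) with locateLetter 0 T u l v split
  ... | inColumn Tpre C Tpost x y T≡ col≡ refl C≡ refl = unbracketedInColumn Tpre C Tpost x y T≡ col≡ C≡ ps ms

  firstMinus⇒inColumn : ∀ T p → firstMinus (signature i T) ≡ just p → UnbracketedInColumn T (minus , p)
  firstMinus⇒inColumn T p fm = unbracketed⇒inColumn T _
    (firstMinus-unbracketed (wordFrom 0 T) p (trans (cong firstMinus (sym (signature≡reduced-wordFrom T))) fm))

  lastPlus⇒inColumn : ∀ T p → firstPlus (reverse (signature i T)) ≡ just p → UnbracketedInColumn T (plus , p)
  lastPlus⇒inColumn T p lp = unbracketed⇒inColumn T _
    (lastPlus-unbracketed (wordFrom 0 T) p (trans (cong (firstPlus ∘ reverse) (sym (signature≡reduced-wordFrom T))) lp))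

  signature-++-∷ : ∀ Tpre C Tpost x l y → columnWord (length Tpre) C ≡ x ++ l ∷ y →
    AllPlus (reduced (wordFrom 0 Tpre ++ x)) → AllMinus (reduced (y ++ wordFrom (suc (length Tpre)) Tpost)) →
    signature i (Tpre ++ C ∷ Tpost) ≡
    reduced (wordFrom 0 Tpre ++ x) ++ l ∷ reduced (y ++ wordFrom (suc (length Tpre)) Tpost)
  signature-++-∷ Tpre C Tpost x l y C≡ ps ms = begin
    signature i (Tpre ++ C ∷ Tpost)                        ≡⟨ signature≡reduced-wordFrom (Tpre ++ C ∷ Tpost) ⟩
    reduced (wordFrom 0 (Tpre ++ C ∷ Tpost))               ≡⟨ cong reduced (wordFrom-++-∷ 0 Tpre C Tpost) ⟩
    reduced (wL ++ columnWord (length Tpre) C ++ wR)        ≡⟨ cong (λ w → reduced (wL ++ w ++ wR)) C≡ ⟩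
    reduced (wL ++ (x ++ l ∷ y) ++ wR)                      ≡⟨ cong reduced (reassoc wL x) ⟩
    reduced ((wL ++ x) ++ l ∷ (y ++ wR))                    ≡⟨ reduced-pivot (wL ++ x) l (y ++ wR) ps ms ⟩
    reduced (wL ++ x) ++ l ∷ reduced (y ++ wR)              ∎
    where
    open ≡-Reasoning
    wL = wordFrom 0 Tpre
    wR = wordFrom (suc (length Tpre)) Tpost
    reassoc : ∀ a b → a ++ (b ++ l ∷ y) ++ wR ≡ (a ++ b) ++ l ∷ (y ++ wR)
    reassoc a b = trans (cong (a ++_) (++-assoc b (l ∷ y) wR)) (sym (++-assoc a b _))

  columnWord-single-sorted : ∀ c C₁ X C₂ → NeutralColumn C₁ → NeutralColumn C₂ → Linked _≤_ X →
    columnWord c (C₁ ++ X ∷ C₂) ≡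
    replicate (multiplicity i X) (plus , c , length C₁) ++ replicate (multiplicity (suc i) X) (minus , c , length C₁)
  columnWord-single-sorted c C₁ X C₂ n₁ n₂ sorted =
    trans (columnWord-single c C₁ X C₂ n₁ n₂) (boxSigns-sorted c (length C₁) X sorted)

  columnWord-pair-sorted : ∀ c C₁ U L₀ C₂ → NeutralColumn C₁ → NeutralColumn C₂ →
    Linked _≤_ U → All (_≤ i) U → Linked _≤_ L₀ → All (suc i ≤_) L₀ →
    columnWord c (C₁ ++ U ∷ (suc i ∷ L₀) ∷ C₂) ≡
    (minus , c , suc (length C₁)) ∷ replicate (multiplicity i U) (plus , c , length C₁)
                                  ++ replicate (multiplicity (suc i) L₀) (minus , c , suc (length C₁))
  columnWord-pair-sorted c C₁ U L₀ C₂ n₁ n₂ U-sorted U≤i L₀-sorted L₀≥1+i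
    rewrite columnWord-pair c C₁ U (suc i ∷ L₀) C₂ n₁ n₂ | signOf-1+i c (suc (length C₁))
          | boxSigns-sorted c (length C₁) U U-sorted | boxSigns-sorted c (suc (length C₁)) L₀ L₀-sorted
          | multiplicity-absent (suc i) U (All.map (λ x≤i x≡1+i → 1+n≰n (subst (_≤ i) x≡1+i x≤i)) U≤i)
          | multiplicity-absent i L₀ (All.map (λ 1+i≤x x≡i → 1+n≰n (subst (suc i ≤_) x≡i 1+i≤x)) L₀≥1+i)
    = cong (λ w → (minus , c , suc r) ∷ w ++ replicate (multiplicity (suc i) L₀) (minus , c , suc r))
           (++-identityʳ (replicate (multiplicity i U) (plus , c , r)))
    where r = length C₁

-- Columns of a tableau

module Shape (i : ℕ) where
  open Word i

  data ColumnShape (C : Column) : Set where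
    neutral : NeutralColumn C → ColumnShape C
    single : ∀ C₁ X C₂ → C ≡ C₁ ++ X ∷ C₂ → NeutralColumn C₁ → NeutralColumn C₂ → ColumnShape C
    pair : ∀ C₁ U L₀ C₂ → C ≡ C₁ ++ U ∷ (suc i ∷ L₀) ∷ C₂ →
           NeutralColumn C₁ → NeutralColumn C₂ →
           i ∈ U → All (_≤ i) U → All (suc i ≤_) L₀ → ColumnShape C

  neutral? : ∀ B → NeutralBox B ⊎ (i ∈ B ⊎ suc i ∈ B)
  neutral? [] = inj₁ []
  neutral? (x ∷ B) with x ≟ i | x ≟ suc i | neutral? B
  ... | yes refl | _ | _ = inj₂ (inj₁ (here refl))
  ... | no _ | yes refl | _ = inj₂ (inj₂ (here refl))
  ... | no x≢i | no x≢1+i | inj₁ nB = inj₁ ((x≢i , x≢1+i) ∷ nB)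
  ... | no _ | no _ | inj₂ (inj₁ i∈B) = inj₂ (inj₁ (there i∈B))
  ... | no _ | no _ | inj₂ (inj₂ 1+i∈B) = inj₂ (inj₂ (there 1+i∈B))

  above-neutral : ∀ {k D} → suc i ≤ k → All (k <_) D → NeutralBox D
  above-neutral 1+i≤k = All.map λ k<x →
    let 1+i<x = ≤-<-trans 1+i≤k k<x in >⇒≢ (<-trans (n<1+n i) 1+i<x) , >⇒≢ 1+i<x

  prepend : ∀ {B C} → NeutralBox B → ColumnShape C → ColumnShape (B ∷ C)
  prepend nB (neutral nC) = neutral (nB ∷ nC)
  prepend nB (single C₁ X C₂ refl n₁ n₂) = single (_ ∷ C₁) X C₂ refl (nB ∷ n₁) n₂
  prepend nB (pair C₁ U L₀ C₂ refl n₁ n₂ i∈U U≤i L₀≥1+i) =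
    pair (_ ∷ C₁) U L₀ C₂ refl (nB ∷ n₁) n₂ i∈U U≤i L₀≥1+i

  -- Below a box with maximum i, only the next box can still contain i+1.
  classify-belowMaxI : ∀ {n B} C → i ∈ B → All (_≤ i) B → All (IsBox n) C → Linked _≺_ (B ∷ C) →
                       ColumnShape (B ∷ C)
  classify-belowMaxI [] _ _ _ _ = single [] _ [] refl [] []
  classify-belowMaxI {B = B} (D ∷ C) i∈B B≤i (D-box ∷ C-boxes) (B≺D ∷ strict)
    with strictly-below {B = B} (D-box ∷ C-boxes) (B≺D ∷ strict) | suc i ∈? D
  ... | D>B ∷ _ | no 1+i∉D =
    single [] B (D ∷ C) refl [] (nD ∷ All.map (above-neutral 1+i≤maxD) (strictly-below {B = D} C-boxes strict))
    where
    D>i : All (i <_) D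
    D>i = All.map (≤-<-trans (∈-maxL B i∈B)) D>B
    nD : NeutralBox D
    nD = All.zipWith (λ (i<x , 1+i≢x) → >⇒≢ i<x , 1+i≢x ∘ sym) (D>i , All.¬Any⇒All¬ D 1+i∉D)
    1+i≤maxD : suc i ≤ maxL D
    1+i≤maxD = ≤-trans (All.lookup D>i (minL∈ D (proj₁ D-box))) (minL≤maxL D (proj₁ D-box))
  ... | D>B ∷ _ | yes 1+i∈D
    with sorted-minimum-head (proj₁ (proj₂ D-box)) 1+i∈D (All.map (≤-<-trans (∈-maxL B i∈B)) D>B)
  ...   | L₀ , refl =
    pair [] B L₀ C refl [] (All.map (above-neutral (∈-maxL D 1+i∈D)) (strictly-below {B = D} C-boxes strict))
      i∈B B≤i (All.tail (All.map (≤-<-trans (∈-maxL B i∈B)) D>B))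

  classify : ∀ {n} C → All (IsBox n) C → Linked _≺_ C → ColumnShape C
  classify [] _ _ = neutral []
  classify (B ∷ C) (_ ∷ C-boxes) strict with neutral? B | suc i ≤? maxL B
  ... | inj₁ nB | _ = prepend nB (classify C C-boxes (Linked.tail strict))
  ... | inj₂ _ | yes 1+i≤maxB =
    single [] B C refl [] (All.map (above-neutral 1+i≤maxB) (strictly-below {B = B} C-boxes strict))
  ... | inj₂ (inj₁ i∈B) | no 1+i≰maxB =
    classify-belowMaxI C i∈B (All.map (λ x≤max → ≤-trans x≤max (≤-pred (≰⇒> 1+i≰maxB))) (All-≤-maxL B))
      C-boxes strict
  ... | inj₂ (inj₂ 1+i∈B) | no 1+i≰maxB = ⊥-elim (1+i≰maxB (∈-maxL B 1+i∈B))

  classify-column : ∀ {n λ′ T} c {C} → IsMVT n λ′ T → nth c T ≡ just C → ColumnShape C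
  classify-column c {C} mvt C≡ = classify C (column-isBoxes c mvt C≡) (column-strict c mvt C≡)

-- The crystal operators

module Crystal (i : ℕ) where
  open Word i
  open Shape i

  lowerE raiseF : Box → Box
  lowerE B = insertM i (removeOne (suc i) B)
  raiseF B = insertM (suc i) (removeOne i B)

  e-firstMinus : ∀ T {T′} → e i T ≡ just T′ → Σ[ p ∈ ℕ × ℕ ] firstMinus (signature i T) ≡ just p
  e-firstMinus T eq with firstMinus (signature i T)
  ... | just p = p , refl

  f-lastPlus : ∀ T {T′} → f i T ≡ just T′ → Σ[ p ∈ ℕ × ℕ ] firstPlus (reverse (signature i T)) ≡ just p
  f-lastPlus T eq with firstPlus (reverse (signature i T))
  ... | just p = p , refl

  e-lowers : ∀ T c r → firstMinus (signature i T) ≡ just (c , r) →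
             (∀ r₀ → r ≡ suc r₀ → contains i (boxAt T c r₀) ≡ false) →
             e i T ≡ just (modifyBox c r lowerE T)
  e-lowers T c r fm above with firstMinus (signature i T)
  e-lowers T c zero refl above | just .(c , zero) = refl
  e-lowers T c (suc r) refl above | just .(c , suc r) rewrite above r refl = refl

  e-moves-up : ∀ T c r → firstMinus (signature i T) ≡ just (c , suc r) → contains i (boxAt T c r) ≡ true →
               e i T ≡ just (modifyBox c r (insertM i) (modifyBox c (suc r) (removeOne (suc i)) T))
  e-moves-up T c r fm above with firstMinus (signature i T)
  e-moves-up T c r refl above | just .(c , suc r) rewrite above = refl

  f-raises : ∀ T c r → firstPlus (reverse (signature i T)) ≡ just (c , r) →
             contains (suc i) (boxAt T c (suc r)) ≡ false → f i T ≡ just (modifyBox c r raiseF T)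
  f-raises T c r lp below with firstPlus (reverse (signature i T))
  f-raises T c r refl below | just .(c , r) rewrite below = refl

  f-moves-down : ∀ T c r → firstPlus (reverse (signature i T)) ≡ just (c , r) →
                 contains (suc i) (boxAt T c (suc r)) ≡ true →
                 f i T ≡ just (modifyBox c (suc r) (insertM (suc i)) (modifyBox c r (removeOne i) T))
  f-moves-down T c r lp below with firstPlus (reverse (signature i T))
  f-moves-down T c r refl below | just .(c , r) rewrite below = refl

  neutral-∌i : ∀ {B} → NeutralBox B → i ∈ B → ⊥
  neutral-∌i nB i∈B = proj₁ (All.lookup nB i∈B) refl

  neutral-∌1+i : ∀ {B} → NeutralBox B → suc i ∈ B → ⊥
  neutral-∌1+i nB 1+i∈B = proj₂ (All.lookup nB 1+i∈B) refl

  neutral-≢i : ∀ {B} → NeutralBox B → All (_≢ i) B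
  neutral-≢i = All.map proj₁

  neutral-≢1+i : ∀ {B} → NeutralBox B → All (_≢ suc i) B
  neutral-≢1+i = All.map proj₂

  isBox-lowerE : ∀ {n} X → 1 ≤ i → i < n → IsBox n X → IsBox n (lowerE X)
  isBox-lowerE X 1≤i i<n (_ , sorted , bounds) =
    isBox-insertM i _ (removeOne-sorted (suc i) X sorted) (All-removeOne (suc i) X bounds) 1≤i (<⇒≤ i<n)

  isBox-raiseF : ∀ {n} X → i < n → IsBox n X → IsBox n (raiseF X)
  isBox-raiseF X i<n (_ , sorted , bounds) =
    isBox-insertM (suc i) _ (removeOne-sorted i X sorted) (All-removeOne i X bounds) (s≤s z≤n) i<n

  neutral-elsewhere : ∀ C₁ X C₂ r {A} → NeutralColumn C₁ → NeutralColumn C₂ →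
                      nth r (C₁ ++ X ∷ C₂) ≡ just A → r ≢ length C₁ → NeutralBox A
  neutral-elsewhere C₁ X C₂ r n₁ n₂ A≡ r≢ with nth-++-∷-inv C₁ X C₂ r A≡
  ... | inj₁ (r≡ , _) = ⊥-elim (r≢ r≡)
  ... | inj₂ A∈ = All.lookup (All.++⁺ n₁ n₂) A∈

  -- If the box left of X held an i+1, it would give an unmatched - before the leftmost unmatched -.
  leftOf-lowered : ∀ {n λ′ T c₀ Cl C₁ X C₂ L} → IsMVT n λ′ T →
    nth c₀ T ≡ just Cl → nth (suc c₀) T ≡ just (C₁ ++ X ∷ C₂) →
    NeutralColumn C₁ → NeutralColumn C₂ → AllPlus (reduced (columnWord c₀ Cl)) →
    nth (length C₁) Cl ≡ just L → suc i ∈ L → minL X ≤ suc i → ⊥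
  leftOf-lowered {T = T} {c₀} {Cl} {C₁} {X} {C₂} {L} mvt Cl≡ C≡ n₁ n₂ Cl-plus L≡ 1+i∈L minX≤1+i
    with classify-column c₀ mvt Cl≡
  ... | neutral nCl = neutral-∌1+i (All.lookup nCl (nth⇒∈ _ Cl L≡)) 1+i∈L
  ... | single C₁′ X′ C₂′ refl n₁′ n₂′ with nth-++-∷-inv C₁′ X′ C₂′ (length C₁) L≡
  ...   | inj₂ L∈ = neutral-∌1+i (All.lookup (All.++⁺ n₁′ n₂′) L∈) 1+i∈L
  ...   | inj₁ (_ , refl) with ∈⇒multiplicity-suc (suc i) L 1+i∈L
  ...     | j , mult≡ = not-allPlus (subst (AllPlus ∘ reduced) word≡ Cl-plus)
    where
    p = (c₀ , length C₁′)
    not-allPlus : ¬ AllPlus (reduced (replicate (multiplicity i L) (plus , p) ++ replicate (suc j) (minus , p)))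
    not-allPlus = reduced-minus-not-allPlus (All.replicate⁺ (multiplicity i L) refl) (All.replicate⁺ (suc j) refl)
    word≡ : columnWord c₀ Cl ≡ replicate (multiplicity i L) (plus , p) ++ replicate (suc j) (minus , p)
    word≡ = trans (columnWord-single-sorted c₀ C₁′ L C₂′ n₁′ n₂′
                     (proj₁ (proj₂ (nth-isBox c₀ _ mvt Cl≡ L≡))))
                  (cong (λ k → replicate (multiplicity i L) (plus , p) ++ replicate k (minus , p)) mult≡)
  leftOf-lowered {T = T} {c₀} {Cl} {C₁} {X} {C₂} {L} mvt Cl≡ C≡ n₁ n₂ Cl-plus L≡ 1+i∈L minX≤1+i
    | pair C₁′ U L₀ C₂′ refl n₁′ n₂′ i∈U U≤i _
    with nth-++-∷-∷-inv C₁′ U (suc i ∷ L₀) C₂′ (length C₁) L≡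
  ... | inj₁ (_ , refl) = 1+n≰n (All.lookup U≤i 1+i∈L)
  ... | inj₂ (inj₂ L∈) = neutral-∌1+i (All.lookup (All.++⁺ n₁′ n₂′) L∈) 1+i∈L
  ... | inj₂ (inj₁ (r≡ , refl)) = neutral-∌i nA (squeezed-∈ A (proj₁ A-box) maxA≤i i≤minA)
    where
    r₀ = length C₁′
    X≡ : nth (suc r₀) (C₁ ++ X ∷ C₂) ≡ just X
    X≡ = nth-++-∷ C₁ X C₂ (suc r₀) r≡
    A = proj₁ (nth-suc⇒nth r₀ (C₁ ++ X ∷ C₂) X≡)
    A≡ : nth r₀ (C₁ ++ X ∷ C₂) ≡ just A
    A≡ = proj₂ (nth-suc⇒nth r₀ (C₁ ++ X ∷ C₂) X≡)
    nA : NeutralBox A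
    nA = neutral-elsewhere C₁ X C₂ r₀ n₁ n₂ A≡ (λ r₀≡ → 1+n≢n (sym (trans r₀≡ r≡)))
    boxA : boxAt T (suc c₀) r₀ ≡ just A
    boxA = trans (boxAt-nth T (suc c₀) r₀ C≡) A≡
    A-box = boxAt-isBox (suc c₀) r₀ mvt boxA
    i≤minA : i ≤ minL A
    i≤minA = ≤-trans (∈-maxL U i∈U)
               (IsMVT.rowCond mvt c₀ r₀ U A (trans (boxAt-nth T c₀ r₀ Cl≡) (nth-++-∷ C₁′ U _ r₀ refl)) boxA)
    boxX : boxAt T (suc c₀) (suc r₀) ≡ just X
    boxX = trans (boxAt-nth T (suc c₀) (suc r₀) C≡) X≡
    maxA≤i : maxL A ≤ i
    maxA≤i = ≤-pred (<-≤-trans (IsMVT.colCond mvt (suc c₀) r₀ A X boxA boxX) minX≤1+i)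

  -- If the box right of X held an i, it would give an unmatched + after the rightmost unmatched +.
  rightOf-raised : ∀ {n λ′ T c C₁ X C₂ Cr R} → IsMVT n λ′ T →
    nth c T ≡ just (C₁ ++ X ∷ C₂) → nth (suc c) T ≡ just Cr →
    NeutralColumn C₁ → NeutralColumn C₂ → AllMinus (reduced (columnWord (suc c) Cr)) →
    nth (length C₁) Cr ≡ just R → i ∈ R → i ≤ maxL X → ⊥
  rightOf-raised {T = T} {c} {C₁} {X} {C₂} {Cr} {R} mvt C≡ Cr≡ n₁ n₂ Cr-minus R≡ i∈R i≤maxX
    with classify-column (suc c) mvt Cr≡
  ... | neutral nCr = neutral-∌i (All.lookup nCr (nth⇒∈ _ Cr R≡)) i∈R
  ... | single C₁′ X′ C₂′ refl n₁′ n₂′ with nth-++-∷-inv C₁′ X′ C₂′ (length C₁) R≡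
  ...   | inj₂ R∈ = neutral-∌i (All.lookup (All.++⁺ n₁′ n₂′) R∈) i∈R
  ...   | inj₁ (_ , refl) with ∈⇒multiplicity-suc i R i∈R
  ...     | j , mult≡ = not-allMinus (subst (AllMinus ∘ reduced) word≡ Cr-minus)
    where
    p = (suc c , length C₁′)
    word≡ : columnWord (suc c) Cr ≡ replicate (suc j) (plus , p) ++ replicate (multiplicity (suc i) R) (minus , p)
    word≡ = trans (columnWord-single-sorted (suc c) C₁′ R C₂′ n₁′ n₂′
                     (proj₁ (proj₂ (nth-isBox (suc c) _ mvt Cr≡ R≡))))
                  (cong (λ k → replicate k (plus , p) ++ replicate (multiplicity (suc i) R) (minus , p)) mult≡)
    not-allMinus : ¬ AllMinus (reduced (replicate (suc j) (plus , p) ++ replicate (multiplicity (suc i) R) (minus , p)))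
    not-allMinus = reduced-plus-not-allMinus (All.replicate⁺ (suc j) refl) (All.replicate⁺ _ refl)
  rightOf-raised {T = T} {c} {C₁} {X} {C₂} {Cr} {R} mvt C≡ Cr≡ n₁ n₂ Cr-minus R≡ i∈R i≤maxX
    | pair C₁′ U L₀ C₂′ refl n₁′ n₂′ _ _ L₀≥1+i
    with nth-++-∷-∷-inv C₁′ U (suc i ∷ L₀) C₂′ (length C₁) R≡
  ... | inj₂ (inj₁ (_ , refl)) = 1+n≰n (All.lookup (≤-refl ∷ L₀≥1+i) i∈R)
  ... | inj₂ (inj₂ R∈) = neutral-∌i (All.lookup (All.++⁺ n₁′ n₂′) R∈) i∈R
  ... | inj₁ (r≡ , refl) = neutral-∌1+i nD (squeezed-∈ D (proj₁ D-box) maxD≤1+i 1+i≤minD)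
    where
    r = length C₁
    boxL : boxAt T (suc c) (suc r) ≡ just (suc i ∷ L₀)
    boxL = trans (boxAt-nth T (suc c) (suc r) Cr≡)
                 (trans (cong (λ k → nth (suc k) (C₁′ ++ U ∷ (suc i ∷ L₀) ∷ C₂′)) r≡)
                        (nth-suc-++-∷ C₁′ U _ _ refl))
    D = proj₁ (boxAt-left c (suc r) mvt boxL)
    boxD : boxAt T c (suc r) ≡ just D
    boxD = proj₂ (boxAt-left c (suc r) mvt boxL)
    D-box = boxAt-isBox c (suc r) mvt boxD
    nD : NeutralBox D
    nD = neutral-elsewhere C₁ X C₂ (suc r) n₁ n₂ (trans (sym (boxAt-nth T c (suc r) C≡)) boxD) 1+n≢n
    boxX : boxAt T c r ≡ just X
    boxX = trans (boxAt-nth T c r C≡) (nth-++-∷ C₁ X C₂ r refl)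
    1+i≤minD : suc i ≤ minL D
    1+i≤minD = ≤-<-trans i≤maxX (IsMVT.colCond mvt c r X D boxX boxD)
    maxD≤1+i : maxL D ≤ suc i
    maxD≤1+i = ≤-trans (IsMVT.rowCond mvt c (suc r) D (suc i ∷ L₀) boxD boxL) (minL-∈ (suc i ∷ L₀) (here refl))

  lowerE-sorted : ∀ X → Linked _≤_ X → Linked _≤_ (lowerE X)
  lowerE-sorted X sorted = insertM-sorted i (removeOne (suc i) X) (removeOne-sorted (suc i) X sorted)

  raiseF-sorted : ∀ X → Linked _≤_ X → Linked _≤_ (raiseF X)
  raiseF-sorted X sorted = insertM-sorted (suc i) (removeOne i X) (removeOne-sorted i X sorted)

  raiseF-lowerE : ∀ X → Linked _≤_ X → suc i ∈ X → raiseF (lowerE X) ≡ X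
  raiseF-lowerE X sorted 1+i∈X =
    trans (cong (insertM (suc i)) (removeOne-insertM i (removeOne (suc i) X))) (insertM-removeOne (suc i) X sorted 1+i∈X)

  lowerE-raiseF : ∀ X → Linked _≤_ X → i ∈ X → lowerE (raiseF X) ≡ X
  lowerE-raiseF X sorted i∈X =
    trans (cong (insertM i) (removeOne-insertM (suc i) (removeOne i X))) (insertM-removeOne i X sorted i∈X)

  multiplicity-lowerE : ∀ X → suc i ∈ X →
    multiplicity i (lowerE X) ≡ suc (multiplicity i X) × suc (multiplicity (suc i) (lowerE X)) ≡ multiplicity (suc i) X
  multiplicity-lowerE X 1+i∈X =
    trans (multiplicity-insertM-same i (removeOne (suc i) X))
          (cong suc (multiplicity-removeOne-other i (suc i) X (λ ()))) ,
    trans (cong suc (multiplicity-insertM-other (suc i) i (removeOne (suc i) X) (λ ())))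
          (multiplicity-removeOne-same (suc i) X 1+i∈X)

  multiplicity-raiseF : ∀ X → i ∈ X →
    suc (multiplicity i (raiseF X)) ≡ multiplicity i X × multiplicity (suc i) (raiseF X) ≡ suc (multiplicity (suc i) X)
  multiplicity-raiseF X i∈X =
    trans (cong suc (multiplicity-insertM-other i (suc i) (removeOne i X) (λ ())))
          (multiplicity-removeOne-same i X i∈X) ,
    trans (multiplicity-insertM-same (suc i) (removeOne i X))
          (cong suc (multiplicity-removeOne-other (suc i) i X (λ ())))

  module SingleBox {n λ′} (Tpre : Tableau) (C₁ : Column) (X : Box) (C₂ : Column) (Tpost : Tableau)
                   (mvt : IsMVT n λ′ (Tpre ++ (C₁ ++ X ∷ C₂) ∷ Tpost))
                   (n₁ : NeutralColumn C₁) (n₂ : NeutralColumn C₂) where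

    withBox : Box → Tableau
    withBox Y = Tpre ++ (C₁ ++ Y ∷ C₂) ∷ Tpost

    c r a b : ℕ
    c = length Tpre
    r = length C₁
    a = multiplicity i X
    b = multiplicity (suc i) X

    P M : SLetter
    P = plus , c , r
    M = minus , c , r

    boxAt-withBox : ∀ Y r′ → boxAt (withBox Y) c r′ ≡ nth r′ (C₁ ++ Y ∷ C₂)
    boxAt-withBox Y = boxAt-++-∷ Tpre (C₁ ++ Y ∷ C₂) Tpost

    X≡ : boxAt (withBox X) c r ≡ just X
    X≡ = trans (boxAt-withBox X r) (nth-++-∷ C₁ X C₂ r refl)

    X-at : ∀ {c′ r′} → c ≡ c′ → r ≡ r′ → boxAt (withBox X) c′ r′ ≡ just X
    X-at refl refl = X≡

    X-sorted : Linked _≤_ X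
    X-sorted = proj₁ (proj₂ (boxAt-isBox c r mvt X≡))

    neutral-at : ∀ Y r′ {A} → r′ ≢ r → boxAt (withBox Y) c r′ ≡ just A → NeutralBox A
    neutral-at Y r′ r′≢r A≡ =
      neutral-elsewhere C₁ Y C₂ r′ n₁ n₂ (trans (sym (boxAt-withBox Y r′)) A≡) r′≢r

    modifyBox-withBox : ∀ g Y → modifyBox c r g (withBox Y) ≡ withBox (g Y)
    modifyBox-withBox g Y =
      trans (modifyBox-++-∷ g r Tpre _ Tpost) (cong (λ C → Tpre ++ C ∷ Tpost) (modifyAt-++-∷ g C₁ Y C₂ r refl))

    contains-elsewhere : ∀ Y k r′ → r′ ≢ r → (∀ {A} → NeutralBox A → All (_≢ k) A) →
                         contains k (boxAt (withBox Y) c r′) ≡ false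
    contains-elsewhere Y k r′ r′≢r ∌k with boxAt (withBox Y) c r′ in A≡
    ... | nothing = refl
    ... | just A = contains-∉ k A (∌k (neutral-at Y r′ r′≢r A≡))

    columnWord-withBox : ∀ Y → Linked _≤_ Y →
      columnWord c (C₁ ++ Y ∷ C₂) ≡ replicate (multiplicity i Y) P ++ replicate (multiplicity (suc i) Y) M
    columnWord-withBox Y = columnWord-single-sorted c C₁ Y C₂ n₁ n₂

    columnWord-X : columnWord c (C₁ ++ X ∷ C₂) ≡ replicate a P ++ replicate b M
    columnWord-X = columnWord-withBox X X-sorted

    firstMinus-in-X : ∀ x l y → columnWord c (C₁ ++ X ∷ C₂) ≡ x ++ l ∷ y → IsMinus l → AllPlus (reduced x) →
                      x ≡ replicate a P × l ≡ M × Σ[ b′ ∈ ℕ ] b ≡ suc b′ × y ≡ replicate b′ M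
    firstMinus-in-X x l y word l-minus x-plus
      with firstMinus-in-reduced x l y (All.replicate⁺ a refl) (All.replicate⁺ b refl)
             (trans (sym word) columnWord-X) l-minus x-plus
    ... | x≡ , l∷y≡ with ∷≡replicate b l∷y≡
    ...   | b′ , mult≡ , l≡ , y≡ = x≡ , l≡ , b′ , mult≡ , y≡

    module Lowering (b′ : ℕ) (mult≡ : b ≡ suc b′)
                    (fm : firstMinus (signature i (withBox X)) ≡ just (c , r))
                    (before : AllPlus (reduced (wordFrom 0 Tpre ++ replicate a P)))
                    (after : AllMinus (reduced (replicate b′ M ++ wordFrom (suc c) Tpost))) where

      1+i∈X : suc i ∈ X
      1+i∈X = multiplicity-suc⇒∈ (suc i) X b′ mult≡

      e≡ : e i (withBox X) ≡ just (withBox (lowerE X))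
      e≡ = trans (e-lowers (withBox X) c r fm above-∌i) (cong just (modifyBox-withBox lowerE X))
        where
        above-∌i : ∀ r₀ → r ≡ suc r₀ → contains i (boxAt (withBox X) c r₀) ≡ false
        above-∌i r₀ r≡ = contains-elsewhere X i r₀ (≡suc⇒≢ r≡) neutral-≢i

      leftColumn-allPlus : a ≡ 0 → ∀ Tpre′ Cl → Tpre ≡ Tpre′ ++ Cl ∷ [] →
                           AllPlus (reduced (columnWord (length Tpre′) Cl))
      leftColumn-allPlus no-i Tpre′ Cl refl =
        subst (AllPlus ∘ reduced) (++-identityʳ (columnWord (length Tpre′) Cl))
          (allPlus-reduced-suffix (wordFrom 0 Tpre′) (columnWord (length Tpre′) Cl ++ [])
            (subst (AllPlus ∘ reduced) (trans (++-identityʳ _) (wordFrom-++-∷ 0 Tpre′ Cl []))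
              (subst (λ k → AllPlus (reduced (wordFrom 0 Tpre ++ replicate k P))) no-i before)))

      left-fits : ∀ {c₀ L} → c ≡ suc c₀ → boxAt (withBox X) c₀ r ≡ just L → maxL L ≤ i
      left-fits {c₀} {L} c≡ L≡ with minL X ≤? i | maxL L ≤? i
      ... | yes minX≤i | _ = ≤-trans L≤X minX≤i
        where L≤X = IsMVT.rowCond mvt c₀ r L X L≡ (X-at c≡ refl)
      ... | no _ | yes maxL≤i = maxL≤i
      ... | no minX≰i | no maxL≰i with split-last Tpre c₀ c≡
      ...   | Tpre′ , Cl , refl , refl =
        ⊥-elim (leftOf-lowered mvt Cl≡ (nth-++-∷ Tpre _ Tpost (suc c₀) c≡) n₁ n₂
                  (leftColumn-allPlus no-i Tpre′ Cl refl) (trans (sym (boxAt-nth (withBox X) c₀ r Cl≡)) L≡)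
                  1+i∈L minX≤1+i)
        where
        no-i : a ≡ 0
        no-i = multiplicity-absent i X
          (All.map (λ minX≤x x≡i → minX≰i (subst (minL X ≤_) x≡i minX≤x)) (All-minL-≤ X))
        Cl≡ : nth c₀ (withBox X) ≡ just Cl
        Cl≡ = trans (cong (nth c₀) (++-assoc Tpre′ (Cl ∷ []) _)) (nth-++-∷ Tpre′ Cl _ c₀ refl)
        minX≤1+i : minL X ≤ suc i
        minX≤1+i = minL-∈ X 1+i∈X
        maxL≤1+i : maxL L ≤ suc i
        maxL≤1+i = ≤-trans (IsMVT.rowCond mvt c₀ r L X L≡ (X-at c≡ refl)) minX≤1+i
        1+i∈L : suc i ∈ L
        1+i∈L = subst (_∈ L) (≤-antisym maxL≤1+i (≰⇒> maxL≰i)) (maxL∈ L (proj₁ (boxAt-isBox c₀ r mvt L≡)))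

      valid : 1 ≤ i → i < n → IsMVT n λ′ (withBox (lowerE X))
      valid 1≤i i<n = subst (IsMVT n λ′) (modifyBox-withBox lowerE X)
        (modifyBox-isMVT lowerE mvt X≡ (isBox-lowerE X 1≤i i<n (boxAt-isBox c r mvt X≡)) fits)
        where
        old = isMVT-fitsAt mvt X≡
        keep : ∀ {P : ℕ → Set} → P i → All P X → All P (lowerE X)
        keep P-i P-X = All-insertM i (removeOne (suc i) X) P-i (All-removeOne (suc i) X P-X)
        i≤maxX : i ≤ maxL X
        i≤maxX = ≤-trans (n≤1+n i) (∈-maxL X 1+i∈X)
        maxA<i : ∀ {r′ A} → r ≡ suc r′ → boxAt (withBox X) c r′ ≡ just A → maxL A < i
        maxA<i {r′} {A} r≡ A≡ = ≤∧≢⇒<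
          (≤-pred (<-≤-trans (IsMVT.colCond mvt c r′ A X A≡ (X-at refl r≡)) (minL-∈ X 1+i∈X)))
          (proj₁ (All.lookup (neutral-at X r′ (≡suc⇒≢ r≡) A≡) (maxL∈ A (proj₁ (boxAt-isBox c r′ mvt A≡)))))
        fits : FitsAt (withBox X) c r (lowerE X)
        fits = record
          { above = λ r≡ A≡ → keep (maxA<i r≡ A≡) (FitsAt.above old r≡ A≡)
          ; below = λ D≡ → keep (≤-<-trans i≤maxX (IsMVT.colCond mvt c r X _ X≡ D≡)) (FitsAt.below old D≡)
          ; left = λ c≡ L≡ → keep (left-fits c≡ L≡) (FitsAt.left old c≡ L≡)
          ; right = λ R≡ → keep (≤-trans i≤maxX (IsMVT.rowCond mvt c r X _ X≡ R≡)) (FitsAt.right old R≡)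
          }

      f≡ : f i (withBox (lowerE X)) ≡ just (withBox X)
      f≡ = begin
        f i (withBox (lowerE X))                         ≡⟨ f-raises (withBox (lowerE X)) c r lp below-∌1+i ⟩
        just (modifyBox c r raiseF (withBox (lowerE X))) ≡⟨ cong just (modifyBox-withBox raiseF (lowerE X)) ⟩
        just (withBox (raiseF (lowerE X)))               ≡⟨ cong (just ∘ withBox) (raiseF-lowerE X X-sorted 1+i∈X) ⟩
        just (withBox X)                                 ∎
        where
        open ≡-Reasoning
        word : columnWord c (C₁ ++ lowerE X ∷ C₂) ≡ replicate a P ++ P ∷ replicate b′ M
        word = trans (columnWord-withBox (lowerE X) (lowerE-sorted X X-sorted))
                 (trans (cong₂ (λ k l → replicate k P ++ replicate l M) (proj₁ (multiplicity-lowerE X 1+i∈X))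
                          (suc-injective (trans (proj₂ (multiplicity-lowerE X 1+i∈X)) mult≡)))
                        (replicate-∷ʳ a P (replicate b′ M)))
        lp : firstPlus (reverse (signature i (withBox (lowerE X)))) ≡ just (c , r)
        lp = trans (cong (firstPlus ∘ reverse)
                     (signature-++-∷ Tpre (C₁ ++ lowerE X ∷ C₂) Tpost
                                     (replicate a P) P (replicate b′ M) word before after))
                   (lastPlus-allMinus (reduced (wordFrom 0 Tpre ++ replicate a P)) (c , r) _ after)
        below-∌1+i : contains (suc i) (boxAt (withBox (lowerE X)) c (suc r)) ≡ false
        below-∌1+i = contains-elsewhere (lowerE X) (suc i) (suc r) 1+n≢n neutral-≢1+i

    lastPlus-in-X : ∀ x l y → columnWord c (C₁ ++ X ∷ C₂) ≡ x ++ l ∷ y → IsPlus l → AllMinus (reduced y) →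
                    Σ[ a′ ∈ ℕ ] a ≡ suc a′ × x ≡ replicate a′ P × l ≡ P × y ≡ replicate b M
    lastPlus-in-X x l y word l-plus y-minus
      with lastPlus-in-reduced x l y (All.replicate⁺ a refl) (All.replicate⁺ b refl)
             (trans (sym word) columnWord-X) l-plus y-minus
    ... | x∷ʳl≡ , y≡ with ∷ʳ≡replicate x a x∷ʳl≡
    ...   | a′ , mult≡ , l≡ , x≡ = a′ , mult≡ , x≡ , l≡ , y≡

    module Raising (a′ : ℕ) (mult≡ : a ≡ suc a′)
                   (lp : firstPlus (reverse (signature i (withBox X))) ≡ just (c , r))
                   (before : AllPlus (reduced (wordFrom 0 Tpre ++ replicate a′ P)))
                   (after : AllMinus (reduced (replicate b M ++ wordFrom (suc c) Tpost))) where

      i∈X : i ∈ X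
      i∈X = multiplicity-suc⇒∈ i X a′ mult≡

      f≡ : f i (withBox X) ≡ just (withBox (raiseF X))
      f≡ = trans (f-raises (withBox X) c r lp (contains-elsewhere X (suc i) (suc r) 1+n≢n neutral-≢1+i))
                 (cong just (modifyBox-withBox raiseF X))

      rightColumn-allMinus : b ≡ 0 → ∀ Cr Tpost′ → Tpost ≡ Cr ∷ Tpost′ →
                             AllMinus (reduced (columnWord (suc c) Cr))
      rightColumn-allMinus no-1+i Cr Tpost′ refl =
        allMinus-reduced-prefix (columnWord (suc c) Cr) (wordFrom (suc (suc c)) Tpost′)
          (subst (λ k → AllMinus (reduced (replicate k M ++ wordFrom (suc c) Tpost))) no-1+i after)

      right-fits : ∀ {R} → boxAt (withBox X) (suc c) r ≡ just R → suc i ≤ minL R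
      right-fits {R} R≡ with suc i ≤? maxL X | suc i ≤? minL R
      ... | yes 1+i≤maxX | _ = ≤-trans 1+i≤maxX (IsMVT.rowCond mvt c r X R X≡ R≡)
      ... | no _ | yes 1+i≤minR = 1+i≤minR
      ... | no 1+i≰maxX | no 1+i≰minR with boxAt⇒nth (withBox X) (suc c) r R≡
      ...   | Cr , Cr≡ , R∈Cr with nth-zero⇒∷ Tpost (trans (sym (nth-suc-++-∷ Tpre _ Tpost c refl)) Cr≡)
      ...     | Tpost′ , Tpost≡ =
        ⊥-elim (rightOf-raised mvt (nth-++-∷ Tpre _ Tpost c refl) Cr≡ n₁ n₂
                  (rightColumn-allMinus no-1+i Cr Tpost′ Tpost≡) R∈Cr i∈R (∈-maxL X i∈X))
        where
        no-1+i : b ≡ 0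
        no-1+i = multiplicity-absent (suc i) X
          (All.map (λ x≤maxX x≡1+i → 1+i≰maxX (subst (_≤ maxL X) x≡1+i x≤maxX)) (All-≤-maxL X))
        i≤minR : i ≤ minL R
        i≤minR = ≤-trans (∈-maxL X i∈X) (IsMVT.rowCond mvt c r X R X≡ R≡)
        i∈R : i ∈ R
        i∈R = subst (_∈ R) (≤-antisym (≤-pred (≰⇒> 1+i≰minR)) i≤minR)
                           (minL∈ R (proj₁ (boxAt-isBox (suc c) r mvt R≡)))

      valid : i < n → IsMVT n λ′ (withBox (raiseF X))
      valid i<n = subst (IsMVT n λ′) (modifyBox-withBox raiseF X)
        (modifyBox-isMVT raiseF mvt X≡ (isBox-raiseF X i<n (boxAt-isBox c r mvt X≡)) fits)
        where
        old = isMVT-fitsAt mvt X≡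
        keep : ∀ {P : ℕ → Set} → P (suc i) → All P X → All P (raiseF X)
        keep P-1+i P-X = All-insertM (suc i) (removeOne i X) P-1+i (All-removeOne i X P-X)
        minX≤1+i : minL X ≤ suc i
        minX≤1+i = ≤-trans (minL-∈ X i∈X) (n≤1+n i)
        1+i<minD : ∀ {D} → boxAt (withBox X) c (suc r) ≡ just D → suc i < minL D
        1+i<minD {D} D≡ = ≤∧≢⇒< (≤-<-trans (∈-maxL X i∈X) (IsMVT.colCond mvt c r X D X≡ D≡))
          (λ 1+i≡minD → proj₂ (All.lookup (neutral-at X (suc r) 1+n≢n D≡)
                                          (minL∈ D (proj₁ (boxAt-isBox c (suc r) mvt D≡)))) (sym 1+i≡minD))
        fits : FitsAt (withBox X) c r (raiseF X)
        fits = record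
          { above = λ r≡ A≡ →
              keep (<-≤-trans (IsMVT.colCond mvt c _ _ X A≡ (X-at refl r≡)) minX≤1+i) (FitsAt.above old r≡ A≡)
          ; below = λ D≡ → keep (1+i<minD D≡) (FitsAt.below old D≡)
          ; left = λ c≡ L≡ →
              keep (≤-trans (IsMVT.rowCond mvt _ r _ X L≡ (X-at c≡ refl)) minX≤1+i) (FitsAt.left old c≡ L≡)
          ; right = λ R≡ → keep (right-fits R≡) (FitsAt.right old R≡)
          }

      e≡ : e i (withBox (raiseF X)) ≡ just (withBox X)
      e≡ = begin
        e i (withBox (raiseF X))                         ≡⟨ e-lowers (withBox (raiseF X)) c r fm above-∌i ⟩
        just (modifyBox c r lowerE (withBox (raiseF X))) ≡⟨ cong just (modifyBox-withBox lowerE (raiseF X)) ⟩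
        just (withBox (lowerE (raiseF X)))               ≡⟨ cong (just ∘ withBox) (lowerE-raiseF X X-sorted i∈X) ⟩
        just (withBox X)                                 ∎
        where
        open ≡-Reasoning
        word : columnWord c (C₁ ++ raiseF X ∷ C₂) ≡ replicate a′ P ++ M ∷ replicate b M
        word = trans (columnWord-withBox (raiseF X) (raiseF-sorted X X-sorted))
                 (cong₂ (λ k l → replicate k P ++ replicate l M)
                   (suc-injective (trans (proj₁ (multiplicity-raiseF X i∈X)) mult≡))
                   (proj₂ (multiplicity-raiseF X i∈X)))
        fm : firstMinus (signature i (withBox (raiseF X))) ≡ just (c , r)
        fm = trans (cong firstMinus
                     (signature-++-∷ Tpre (C₁ ++ raiseF X ∷ C₂) Tpost
                                     (replicate a′ P) M (replicate b M) word before after))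
                   (firstMinus-allPlus (reduced (wordFrom 0 Tpre ++ replicate a′ P)) (c , r) _ before)
        above-∌i : ∀ r₀ → r ≡ suc r₀ → contains i (boxAt (withBox (raiseF X)) c r₀) ≡ false
        above-∌i r₀ r≡ = contains-elsewhere (raiseF X) i r₀ (≡suc⇒≢ r≡) neutral-≢i

  module PairBox {n λ′} (Tpre : Tableau) (C₁ : Column) (U L₀ : Box) (C₂ : Column) (Tpost : Tableau)
                 (mvt : IsMVT n λ′ (Tpre ++ (C₁ ++ U ∷ (suc i ∷ L₀) ∷ C₂) ∷ Tpost))
                 (n₁ : NeutralColumn C₁) (n₂ : NeutralColumn C₂)
                 (i∈U : i ∈ U) (U≤i : All (_≤ i) U) (L₀≥1+i : All (suc i ≤_) L₀) where

    withPair : Box → Box → Tableau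
    withPair V W = Tpre ++ (C₁ ++ V ∷ W ∷ C₂) ∷ Tpost

    c r a b : ℕ
    c = length Tpre
    r = length C₁
    a = multiplicity i U
    b = multiplicity (suc i) L₀

    P M : SLetter
    P = plus , c , r
    M = minus , c , suc r

    boxAt-upper : ∀ V W → boxAt (withPair V W) c r ≡ just V
    boxAt-upper V W = trans (boxAt-++-∷ Tpre _ Tpost r) (nth-++-∷ C₁ V (W ∷ C₂) r refl)

    boxAt-lower : ∀ V W → boxAt (withPair V W) c (suc r) ≡ just W
    boxAt-lower V W = trans (boxAt-++-∷ Tpre _ Tpost (suc r)) (nth-suc-++-∷ C₁ V (W ∷ C₂) r refl)

    modifyBoxes-upper-lower : ∀ g h V W →
      modifyBox c r g (modifyBox c (suc r) h (withPair V W)) ≡ withPair (g V) (h W)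
    modifyBoxes-upper-lower g h V W
      rewrite modifyBox-++-∷ h (suc r) Tpre (C₁ ++ V ∷ W ∷ C₂) Tpost | modifyAt-suc-++-∷-∷ h C₁ V W C₂ r refl
            | modifyBox-++-∷ g r Tpre (C₁ ++ V ∷ h W ∷ C₂) Tpost | modifyAt-++-∷ g C₁ V (h W ∷ C₂) r refl
            = refl

    modifyBoxes-lower-upper : ∀ g h V W →
      modifyBox c (suc r) h (modifyBox c r g (withPair V W)) ≡ withPair (g V) (h W)
    modifyBoxes-lower-upper g h V W
      rewrite modifyBox-++-∷ g r Tpre (C₁ ++ V ∷ W ∷ C₂) Tpost | modifyAt-++-∷ g C₁ V (W ∷ C₂) r refl
            | modifyBox-++-∷ h (suc r) Tpre (C₁ ++ g V ∷ W ∷ C₂) Tpost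
            | modifyAt-suc-++-∷-∷ h C₁ (g V) W C₂ r refl
            = refl

    U-box : IsBox n U
    U-box = boxAt-isBox c r mvt (boxAt-upper U (suc i ∷ L₀))

    U-sorted : Linked _≤_ U
    U-sorted = proj₁ (proj₂ U-box)

    L-box : IsBox n (suc i ∷ L₀)
    L-box = boxAt-isBox c (suc r) mvt (boxAt-lower U (suc i ∷ L₀))

    L₀-sorted : Linked _≤_ L₀
    L₀-sorted = Linked.tail (proj₁ (proj₂ L-box))

    lower-∋1+i : ∀ V W → contains (suc i) (boxAt (withPair V (suc i ∷ W)) c (suc r)) ≡ true
    lower-∋1+i V W =
      trans (cong (contains (suc i)) (boxAt-lower V (suc i ∷ W))) (contains-∈ (suc i) (suc i ∷ W) (here refl))

    columnWord-withPair : ∀ V W₀ → Linked _≤_ V → All (_≤ i) V → Linked _≤_ W₀ → All (suc i ≤_) W₀ →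
      columnWord c (C₁ ++ V ∷ (suc i ∷ W₀) ∷ C₂) ≡
      M ∷ replicate (multiplicity i V) P ++ replicate (multiplicity (suc i) W₀) M
    columnWord-withPair V W₀ = columnWord-pair-sorted c C₁ V W₀ C₂ n₁ n₂

    word : columnWord c (C₁ ++ U ∷ (suc i ∷ L₀) ∷ C₂) ≡ M ∷ replicate a P ++ replicate b M
    word = columnWord-withPair U L₀ U-sorted U≤i L₀-sorted L₀≥1+i

    firstMinus-in-pair : ∀ x l y → columnWord c (C₁ ++ U ∷ (suc i ∷ L₀) ∷ C₂) ≡ x ++ l ∷ y →
      IsMinus l → AllPlus (reduced x) → AllMinus (reduced y) →
      x ≡ M ∷ replicate a P × l ≡ M × Σ[ b′ ∈ ℕ ] b ≡ suc b′ × y ≡ replicate b′ M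
    firstMinus-in-pair [] l y w _ _ y-minus with ∈⇒multiplicity-suc i U i∈U | ∷-injective (trans (sym w) word)
    ... | a₀ , mult≡ | _ , y≡ rewrite mult≡ =
      ⊥-elim (reduced-plus-not-allMinus (All.replicate⁺ (suc a₀) refl) (All.replicate⁺ b refl)
                (subst (AllMinus ∘ reduced) y≡ y-minus))
    firstMinus-in-pair (x₀ ∷ x) l y w l-minus x-plus _ with ∷-injective (trans (sym w) word)
    ... | refl , w′ with firstMinus-in-reduced x l y (All.replicate⁺ a refl) (All.replicate⁺ b refl) w′ l-minus
                           (allPlus-pushSign M (reduced x) x-plus)
    ...   | refl , l∷y≡ with ∷≡replicate b l∷y≡
    ...     | b′ , mult≡ , l≡ , y≡ = refl , l≡ , b′ , mult≡ , y≡

    lastPlus-in-pair : ∀ x l y → columnWord c (C₁ ++ U ∷ (suc i ∷ L₀) ∷ C₂) ≡ x ++ l ∷ y →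
      IsPlus l → AllPlus (reduced x) → AllMinus (reduced y) →
      Σ[ a′ ∈ ℕ ] a ≡ suc (suc a′) × x ≡ M ∷ replicate (suc a′) P × l ≡ P × y ≡ replicate b M
    lastPlus-in-pair [] l y w l-plus _ _ with ∷-injective (trans (sym w) word)
    ... | refl , _ with l-plus
    ...   | ()
    lastPlus-in-pair (x₀ ∷ x) l y w l-plus x-plus y-minus with ∷-injective (trans (sym w) word)
    ... | refl , w′ with lastPlus-in-reduced x l y (All.replicate⁺ a refl) (All.replicate⁺ b refl) w′ l-plus y-minus
    ...   | x∷ʳl≡ , y≡ with ∷ʳ≡replicate x a x∷ʳl≡
    ...     | zero , _ , _ , refl with x-plus
    ...       | () ∷ _
    lastPlus-in-pair (x₀ ∷ x) l y w l-plus x-plus y-minus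
      | refl , w′ | x∷ʳl≡ , y≡ | suc a′ , mult≡ , l≡ , refl = a′ , mult≡ , refl , l≡ , y≡

    module MovingUp (b′ : ℕ) (mult≡ : b ≡ suc b′)
                    (fm : firstMinus (signature i (withPair U (suc i ∷ L₀))) ≡ just (c , suc r))
                    (before : AllPlus (reduced (wordFrom 0 Tpre ++ M ∷ replicate a P)))
                    (after : AllMinus (reduced (replicate b′ M ++ wordFrom (suc c) Tpost))) where

      1+i∈L₀ : suc i ∈ L₀
      1+i∈L₀ = multiplicity-suc⇒∈ (suc i) L₀ b′ mult≡

      e≡ : e i (withPair U (suc i ∷ L₀)) ≡ just (withPair (insertM i U) L₀)
      e≡ = begin
        e i (withPair U (suc i ∷ L₀))
          ≡⟨ e-moves-up _ c r fm (trans (cong (contains i) (boxAt-upper U _)) (contains-∈ i U i∈U)) ⟩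
        just (modifyBox c r (insertM i) (modifyBox c (suc r) (removeOne (suc i)) (withPair U (suc i ∷ L₀))))
          ≡⟨ cong just (modifyBoxes-upper-lower (insertM i) (removeOne (suc i)) U (suc i ∷ L₀)) ⟩
        just (withPair (insertM i U) (removeOne (suc i) (suc i ∷ L₀)))
          ≡⟨ cong (just ∘ withPair (insertM i U)) (removeOne-head (suc i) L₀) ⟩
        just (withPair (insertM i U) L₀) ∎
        where open ≡-Reasoning

      valid : 1 ≤ i → i < n → IsMVT n λ′ (withPair (insertM i U) L₀)
      valid 1≤i i<n = subst (IsMVT n λ′)
        (trans (modifyBoxes-upper-lower (insertM i) (removeOne (suc i)) U (suc i ∷ L₀))
               (cong (withPair (insertM i U)) (removeOne-head (suc i) L₀)))
        (modifyBox-isMVT-sub (insertM i) lowered U≡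
           (isBox-insertM i U U-sorted (proj₂ (proj₂ U-box)) 1≤i (<⇒≤ i<n))
           (λ all → All-insertM i U (All.lookup all i∈U) all))
        where
        lowered : IsMVT n λ′ (modifyBox c (suc r) (removeOne (suc i)) (withPair U (suc i ∷ L₀)))
        lowered = modifyBox-isMVT-sub (removeOne (suc i)) mvt (boxAt-lower U _)
          (isBox-removeOne (suc i) (suc i ∷ L₀) L-box (subst (suc i ∈_) (sym (removeOne-head (suc i) L₀)) 1+i∈L₀))
          (All-removeOne (suc i) (suc i ∷ L₀))
        U≡ : boxAt (modifyBox c (suc r) (removeOne (suc i)) (withPair U (suc i ∷ L₀))) c r ≡ just U
        U≡ = trans (boxAt-modifyBox-other (removeOne (suc i)) c (suc r) (withPair U (suc i ∷ L₀)) c r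
                                          (inj₂ (1+n≢n ∘ sym)))
                   (boxAt-upper U (suc i ∷ L₀))

      f≡ : f i (withPair (insertM i U) L₀) ≡ just (withPair U (suc i ∷ L₀))
      f≡ with sorted-minimum-head L₀-sorted 1+i∈L₀ L₀≥1+i
      ... | L₁ , refl = begin
        f i (withPair (insertM i U) (suc i ∷ L₁))
          ≡⟨ f-moves-down _ c r lp (lower-∋1+i (insertM i U) L₁) ⟩
        just (modifyBox c (suc r) (insertM (suc i)) (modifyBox c r (removeOne i) (withPair (insertM i U) (suc i ∷ L₁))))
          ≡⟨ cong just (modifyBoxes-lower-upper (removeOne i) (insertM (suc i)) (insertM i U) (suc i ∷ L₁)) ⟩
        just (withPair (removeOne i (insertM i U)) (insertM (suc i) (suc i ∷ L₁)))
          ≡⟨ cong₂ (λ V W → just (withPair V W)) (removeOne-insertM i U) (insertM-head (suc i) L₁) ⟩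
        just (withPair U (suc i ∷ suc i ∷ L₁)) ∎
        where
        open ≡-Reasoning
        word′ : columnWord c (C₁ ++ insertM i U ∷ (suc i ∷ L₁) ∷ C₂) ≡
                (M ∷ replicate a P) ++ P ∷ replicate b′ M
        word′ = trans (columnWord-withPair (insertM i U) L₁ (insertM-sorted i U U-sorted) (All-insertM i U ≤-refl U≤i)
                         (Linked.tail L₀-sorted) (All.tail L₀≥1+i))
                  (cong (M ∷_) (trans (cong₂ (λ k l → replicate k P ++ replicate l M) (multiplicity-insertM-same i U)
                                        (suc-injective (trans (sym (multiplicity-here (suc i) L₁)) mult≡)))
                                      (replicate-∷ʳ a P (replicate b′ M))))
        lp : firstPlus (reverse (signature i (withPair (insertM i U) (suc i ∷ L₁)))) ≡ just (c , r)
        lp = trans (cong (firstPlus ∘ reverse)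
                     (signature-++-∷ Tpre (C₁ ++ insertM i U ∷ (suc i ∷ L₁) ∷ C₂) Tpost
                                     (M ∷ replicate a P) P (replicate b′ M) word′ before after))
                   (lastPlus-allMinus (reduced (wordFrom 0 Tpre ++ M ∷ replicate a P)) (c , r) _ after)

    module MovingDown (a′ : ℕ) (mult≡ : a ≡ suc (suc a′))
                      (lp : firstPlus (reverse (signature i (withPair U (suc i ∷ L₀)))) ≡ just (c , r))
                      (before : AllPlus (reduced (wordFrom 0 Tpre ++ M ∷ replicate (suc a′) P)))
                      (after : AllMinus (reduced (replicate b M ++ wordFrom (suc c) Tpost))) where

      U′ : Box
      U′ = removeOne i U

      multiplicity-U′ : multiplicity i U′ ≡ suc a′
      multiplicity-U′ = suc-injective (trans (multiplicity-removeOne-same i U i∈U) mult≡)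

      i∈U′ : i ∈ U′
      i∈U′ = multiplicity-suc⇒∈ i U′ a′ multiplicity-U′

      f≡ : f i (withPair U (suc i ∷ L₀)) ≡ just (withPair U′ (suc i ∷ suc i ∷ L₀))
      f≡ = begin
        f i (withPair U (suc i ∷ L₀))
          ≡⟨ f-moves-down _ c r lp (lower-∋1+i U L₀) ⟩
        just (modifyBox c (suc r) (insertM (suc i)) (modifyBox c r (removeOne i) (withPair U (suc i ∷ L₀))))
          ≡⟨ cong just (modifyBoxes-lower-upper (removeOne i) (insertM (suc i)) U (suc i ∷ L₀)) ⟩
        just (withPair U′ (insertM (suc i) (suc i ∷ L₀)))
          ≡⟨ cong (just ∘ withPair U′) (insertM-head (suc i) L₀) ⟩
        just (withPair U′ (suc i ∷ suc i ∷ L₀)) ∎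
        where open ≡-Reasoning

      valid : i < n → IsMVT n λ′ (withPair U′ (suc i ∷ suc i ∷ L₀))
      valid i<n = subst (IsMVT n λ′)
        (trans (modifyBoxes-lower-upper (removeOne i) (insertM (suc i)) U (suc i ∷ L₀))
               (cong (withPair U′) (insertM-head (suc i) L₀)))
        (modifyBox-isMVT-sub (insertM (suc i)) raised L≡
           (isBox-insertM (suc i) (suc i ∷ L₀) (proj₁ (proj₂ L-box)) (proj₂ (proj₂ L-box)) (s≤s z≤n) i<n)
           (λ all → All-insertM (suc i) (suc i ∷ L₀) (All.head all) all))
        where
        raised : IsMVT n λ′ (modifyBox c r (removeOne i) (withPair U (suc i ∷ L₀)))
        raised = modifyBox-isMVT-sub (removeOne i) mvt (boxAt-upper U (suc i ∷ L₀))
          (isBox-removeOne i U U-box i∈U′) (All-removeOne i U)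
        L≡ : boxAt (modifyBox c r (removeOne i) (withPair U (suc i ∷ L₀))) c (suc r) ≡ just (suc i ∷ L₀)
        L≡ = trans (boxAt-modifyBox-other (removeOne i) c r (withPair U (suc i ∷ L₀)) c (suc r) (inj₂ 1+n≢n))
                   (boxAt-lower U (suc i ∷ L₀))

      e≡ : e i (withPair U′ (suc i ∷ suc i ∷ L₀)) ≡ just (withPair U (suc i ∷ L₀))
      e≡ = begin
        e i (withPair U′ (suc i ∷ suc i ∷ L₀))
          ≡⟨ e-moves-up _ c r fm (trans (cong (contains i) (boxAt-upper U′ _)) (contains-∈ i U′ i∈U′)) ⟩
        just (modifyBox c r (insertM i) (modifyBox c (suc r) (removeOne (suc i)) (withPair U′ (suc i ∷ suc i ∷ L₀))))
          ≡⟨ cong just (modifyBoxes-upper-lower (insertM i) (removeOne (suc i)) U′ (suc i ∷ suc i ∷ L₀)) ⟩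
        just (withPair (insertM i U′) (removeOne (suc i) (suc i ∷ suc i ∷ L₀)))
          ≡⟨ cong₂ (λ V W → just (withPair V W)) (insertM-removeOne i U U-sorted i∈U)
                                                 (removeOne-head (suc i) (suc i ∷ L₀)) ⟩
        just (withPair U (suc i ∷ L₀)) ∎
        where
        open ≡-Reasoning
        word′ : columnWord c (C₁ ++ U′ ∷ (suc i ∷ suc i ∷ L₀) ∷ C₂) ≡
                (M ∷ replicate (suc a′) P) ++ M ∷ replicate b M
        word′ = trans (columnWord-withPair U′ (suc i ∷ L₀) (removeOne-sorted i U U-sorted) (All-removeOne i U U≤i)
                         (proj₁ (proj₂ L-box)) (≤-refl ∷ L₀≥1+i))
                  (cong₂ (λ k l → M ∷ replicate k P ++ replicate l M) multiplicity-U′ (multiplicity-here (suc i) L₀))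
        fm : firstMinus (signature i (withPair U′ (suc i ∷ suc i ∷ L₀))) ≡ just (c , suc r)
        fm = trans (cong firstMinus
                     (signature-++-∷ Tpre (C₁ ++ U′ ∷ (suc i ∷ suc i ∷ L₀) ∷ C₂) Tpost
                                     (M ∷ replicate (suc a′) P) M (replicate b M) word′ before after))
                   (firstMinus-allPlus (reduced (wordFrom 0 Tpre ++ M ∷ replicate (suc a′) P)) (c , suc r) _ before)

  transport-computed : ∀ {n λ′ T T′ T″} (op op⁻¹ : Tableau → Maybe Tableau) →
                       op T ≡ just T′ → op T ≡ just T″ → IsMVT n λ′ T″ → op⁻¹ T″ ≡ just T →
                       IsMVT n λ′ T′ × op⁻¹ T′ ≡ just T
  transport-computed op op⁻¹ eq eq′ valid back rewrite just-injective (trans (sym eq) eq′) = valid , back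

  e-inverse : ∀ {n λ′ T T′} → 1 ≤ i → i < n → IsMVT n λ′ T → e i T ≡ just T′ →
              IsMVT n λ′ T′ × f i T′ ≡ just T
  e-inverse {T = T} 1≤i i<n mvt eq with e-firstMinus T eq
  ... | p , fm with firstMinus⇒inColumn T p fm
  ... | unbracketedInColumn Tpre C Tpost x y refl refl word before after
    with classify-column (length Tpre) mvt (nth-++-∷ Tpre C Tpost _ refl)
  ... | neutral nC with () ← ++-conicalʳ x _ (trans (sym word) (columnWord-neutral _ C nC))
  ... | single C₁ X C₂ refl n₁ n₂
    with SingleBox.firstMinus-in-X Tpre C₁ X C₂ Tpost mvt n₁ n₂ x _ y word refl
           (allPlus-reduced-suffix (wordFrom 0 Tpre) x before)
  ...   | refl , refl , b′ , mult≡ , refl = transport-computed (e i) (f i) eq e≡ (valid 1≤i i<n) f≡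
    where open SingleBox.Lowering Tpre C₁ X C₂ Tpost mvt n₁ n₂ b′ mult≡ fm before after
  e-inverse {T = T} 1≤i i<n mvt eq | p , fm | unbracketedInColumn Tpre C Tpost x y refl refl word before after
    | pair C₁ U L₀ C₂ refl n₁ n₂ i∈U U≤i L₀≥1+i
    with PairBox.firstMinus-in-pair Tpre C₁ U L₀ C₂ Tpost mvt n₁ n₂ i∈U U≤i L₀≥1+i x _ y word refl
           (allPlus-reduced-suffix (wordFrom 0 Tpre) x before) (allMinus-reduced-prefix y _ after)
  ... | refl , refl , b′ , mult≡ , refl = transport-computed (e i) (f i) eq e≡ (valid 1≤i i<n) f≡
    where open PairBox.MovingUp Tpre C₁ U L₀ C₂ Tpost mvt n₁ n₂ i∈U U≤i L₀≥1+i b′ mult≡ fm before after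

  f-inverse : ∀ {n λ′ T T′} → i < n → IsMVT n λ′ T → f i T ≡ just T′ →
              IsMVT n λ′ T′ × e i T′ ≡ just T
  f-inverse {T = T} i<n mvt eq with f-lastPlus T eq
  ... | p , lp with lastPlus⇒inColumn T p lp
  ... | unbracketedInColumn Tpre C Tpost x y refl refl word before after
    with classify-column (length Tpre) mvt (nth-++-∷ Tpre C Tpost _ refl)
  ... | neutral nC with () ← ++-conicalʳ x _ (trans (sym word) (columnWord-neutral _ C nC))
  ... | single C₁ X C₂ refl n₁ n₂
    with SingleBox.lastPlus-in-X Tpre C₁ X C₂ Tpost mvt n₁ n₂ x _ y word refl (allMinus-reduced-prefix y _ after)
  ...   | a′ , mult≡ , refl , refl , refl = transport-computed (f i) (e i) eq f≡ (valid i<n) e≡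
    where open SingleBox.Raising Tpre C₁ X C₂ Tpost mvt n₁ n₂ a′ mult≡ lp before after
  f-inverse {T = T} i<n mvt eq | p , lp | unbracketedInColumn Tpre C Tpost x y refl refl word before after
    | pair C₁ U L₀ C₂ refl n₁ n₂ i∈U U≤i L₀≥1+i
    with PairBox.lastPlus-in-pair Tpre C₁ U L₀ C₂ Tpost mvt n₁ n₂ i∈U U≤i L₀≥1+i x _ y word refl
           (allPlus-reduced-suffix (wordFrom 0 Tpre) x before) (allMinus-reduced-prefix y _ after)
  ... | a′ , mult≡ , refl , refl , refl = transport-computed (f i) (e i) eq f≡ (valid i<n) e≡
    where open PairBox.MovingDown Tpre C₁ U L₀ C₂ Tpost mvt n₁ n₂ i∈U U≤i L₀≥1+i a′ mult≡ lp before after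

e-closed : ∀ {n λ′} i T → 1 ≤ i → i < n → IsMVT n λ′ T → InMVTor0 n λ′ (e i T)
e-closed i T 1≤i i<n mvt with e i T in eq
... | nothing = tt
... | just _ = proj₁ (Crystal.e-inverse i 1≤i i<n mvt eq)

f-closed : ∀ {n λ′} i T → i < n → IsMVT n λ′ T → InMVTor0 n λ′ (f i T)
f-closed i T i<n mvt with f i T in eq
... | nothing = tt
... | just _ = proj₁ (Crystal.f-inverse i i<n mvt eq)

-- 2 ≤ n follows from 1 ≤ i < n, and only the column lengths in IsMVT.shape, not IsPartition, are used.
lemma3p7 : (n : ℕ) → 2 ≤ n → (λ′ : List ℕ) → IsPartition λ′ →
           (i : ℕ) → 1 ≤ i → i < n →
           (T T′ : Tableau) → IsMVT n λ′ T → IsMVT n λ′ T′ →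
           InMVTor0 n λ′ (e i T) × InMVTor0 n λ′ (f i T′) ×
           (e i T ≡ just T′ ⇔ f i T′ ≡ just T)
lemma3p7 n _ λ′ _ i 1≤i i<n T T′ mvt mvt′ =
  e-closed i T 1≤i i<n mvt , f-closed i T′ i<n mvt′ ,
  mk⇔ (proj₂ ∘ Crystal.e-inverse i 1≤i i<n mvt) (proj₂ ∘ Crystal.f-inverse i i<n mvt′)
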